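{- Let $n\ge1$, let $\mathcal H\subset\mathbf{RP}^n$ be a finite subset and let $\langle w\rangle\in\mathbf{RP}^n$. Then $$\eta^{\bigstar}_n(\mathcal H\cup\{\langle w\rangle\})\ \le\ \sum_{\{\langle w_{i_1}\rangle,\dots,\langle w_{i_n}\rangle\}\subset\mathcal H}\eta^{\bigstar}_n\bigl(\{\langle w\rangle,\langle w_{i_1}\rangle,\dots,\langle w_{i_n}\rangle\}\bigr),$$ the sum being over all $n$-element subsets of $\mathcal H$.
   Context: $\mathbf{RP}^n$ is the set of $1$-dimensional subspaces of $\mathbf R^{n+1}$; for $v\ne0$ write $\langle v\rangle$ for the line it spans. Let $\mathcal H=\{\langle w_1\rangle,\dots,\langle w_T\rangle\}\subset\mathbf{RP}^n$ be a finite set of $T$ distinct points, and let an order on $\mathcal H$ be a bijection $\pi:[T]\to\mathcal H$, $\pi(i)=\langle w_i\rangle$. An ordered $n$-tuple $(\langle w_{i_1}\rangle,\dots,\langle w_{i_n}\rangle)$ of distinct elements of $\mathcal H$ satisfies the $\eta^\pi_n(\mathcal H)$ condition if (1) $2\le i_1<\dots<i_n\le T$, and (2) for every $l=1,\dots,n$, $\langle w_{i_l}\rangle$ is the $\pi$-minimal element among all points of $\mathcal H$ contained in $\mathrm{span}(w_{i_l},\dots,w_{i_n})$. Let $B^\pi(\mathcal H)$ be the set of such tuples with $w_{i_1},\dots,w_{i_n}$ linearly independent. It is a known fact that $|B^\pi(\mathcal H)|$ does not depend on $\pi$; this common value is denoted $\eta^{\bigstar}_n(\mathcal H)$. -}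

module Defs where

open import Level using (0ℓ)
open import Data.Nat using (ℕ; zero; suc; _≤_; _≡ᵇ_)
open import Data.Bool using (Bool; true; false; if_then_else_)
open import Data.Fin using (Fin; toℕ) renaming (zero to fz; suc to fs)
open import Data.Fin.Subset using (Subset; _∈_; _∉_; ∣_∣)
open import Data.Vec using (Vec; []; _∷_)
open import Data.List using (List; []; _∷_; _++_; map; length)
open import Data.Nat.ListAction using (sum)
open import Data.List.Relation.Unary.All using (All)
open import Data.List.Relation.Unary.Unique.Propositional using (Unique)
import Data.List.Membership.Propositional as LM
open import Data.Product using (Σ; ∃; _×_; _,_)
open import Relation.Nullary using (¬_)
open import Relation.Binary.PropositionalEquality using (_≡_; _≢_)
open import Relation.Binary.Structures using (IsTotalOrder)
open import Algebra.Structures using (IsCommutativeRing)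

-- The real numbers, axiomatised as a complete ordered field
-- (any such structure is isomorphic to ℝ).

record RealField : Set₁ where
  infixl 6 _+_
  infixl 7 _*_
  field
    Carrier : Set
    0# 1#   : Carrier
    _+_ _*_ : Carrier → Carrier → Carrier
    -_      : Carrier → Carrier
    _≤ᵣ_     : Carrier → Carrier → Set
    isCommutativeRing : IsCommutativeRing _≡_ _+_ _*_ -_ 0# 1#
    0≢1     : 0# ≢ 1#
    inverse : ∀ x → x ≢ 0# → ∃ λ y → x * y ≡ 1#
    isTotalOrder : IsTotalOrder _≡_ _≤ᵣ_
    +-mono  : ∀ x y z → x ≤ᵣ y → (x + z) ≤ᵣ (y + z)
    *-pos   : ∀ x y → 0# ≤ᵣ x → 0# ≤ᵣ y → 0# ≤ᵣ (x * y)
    complete : (S : Carrier → Set) → (∃ S) → (∃ λ b → ∀ x → S x → x ≤ᵣ b) →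
               ∃ λ s → (∀ x → S x → x ≤ᵣ s) × (∀ b → (∀ x → S x → x ≤ᵣ b) → s ≤ᵣ b)

allSubsets : ∀ T → List (Subset T)
allSubsets zero = [] ∷ []
allSubsets (suc T) = map (true ∷_) (allSubsets T) ++ map (false ∷_) (allSubsets T)

-- Linear algebra in R^{n+1}; points of RP^n are represented by nonzero vectors.
module Lin (F : RealField) (n : ℕ) where
  open RealField F hiding (_≤ᵣ_)

  V : Set
  V = Fin (suc n) → Carrier

  sumF : ∀ {T} → (Fin T → Carrier) → Carrier
  sumF {zero} f = 0#
  sumF {suc T} f = f fz + sumF (λ i → f (fs i))

  lincomb : ∀ {T} → (Fin T → V) → (Fin T → Carrier) → V
  lincomb H c k = sumF (λ i → c i * H i k)

  NonZeroV : V → Set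
  NonZeroV v = ¬ (∀ k → v k ≡ 0#)

  -- v is a scalar multiple of u (for nonzero v, u: ⟨v⟩ = ⟨u⟩)
  Proportional : V → V → Set
  Proportional v u = ∃ λ a → ∀ k → v k ≡ a * u k

  InSpanOf : ∀ {T} → (Fin T → V) → (Fin T → Set) → V → Set
  InSpanOf H Q v = ∃ λ c → (∀ i → ¬ Q i → c i ≡ 0#) × (∀ k → v k ≡ lincomb H c k)

  LinIndepOn : ∀ {T} → (Fin T → V) → Subset T → Set
  LinIndepOn H S = ∀ c → (∀ i → i ∉ S → c i ≡ 0#) → (∀ k → lincomb H c k ≡ 0#) → ∀ i → c i ≡ 0#

  -- H : Fin T → V is an enumeration (order π) of T distinct points of RP^n
  Distinct : ∀ {T} → (Fin T → V) → Set
  Distinct H = (∀ i → NonZeroV (H i)) × (∀ i j → Proportional (H i) (H j) → i ≡ j)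

  -- An increasing n-tuple of indices (i_1 < ... < i_n) is encoded as the subset S.
  -- (Indices are 0-based here, so "i_1 ≥ 2" becomes "toℕ i ≥ 1".)
  B : ∀ {T} → (Fin T → V) → Subset T → Set
  B H S = (∣ S ∣ ≡ n)
        × (∀ i → i ∈ S → 1 ≤ toℕ i)
        × (∀ l → l ∈ S → ∀ j → InSpanOf H (λ i → i ∈ S × toℕ l ≤ toℕ i) (H j) → toℕ l ≤ toℕ j)
        × LinIndepOn H S

  Count : ∀ {T} → (Subset T → Set) → ℕ → Set
  Count {T} P k = Σ (List (Subset T)) λ xs →
    Unique xs × All P xs × (∀ s → P s → s LM.∈ xs) × length xs ≡ k

  Enumerates : ∀ {T} → (Fin T → V) → (V → Set) → Set
  Enumerates G P = ∀ v → NonZeroV v → (P v → ∃ λ j → Proportional v (G j)) × ((∃ λ j → Proportional v (G j)) → P v)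

  -- EtaStar P k : η★_n of the finite point set { ⟨v⟩ : P v } equals k
  -- (computed with respect to some order; independent of the order by the known fact).
  EtaStar : (V → Set) → ℕ → Set
  EtaStar P k = Σ ℕ λ T → Σ (Fin T → V) λ G → Distinct G × Enumerates G P × Count (B G) k

  sumOverNSubsets : ∀ T → (Subset T → ℕ) → ℕ
  sumOverNSubsets T c = sum (map (λ S → if ∣ S ∣ ≡ᵇ n then c S else 0) (allSubsets T))

-- Count with ⟨w⟩ moved to the front of the order. Moving it forward one place swaps adjacent
-- points a, b. A tuple S stays valid unless ⟨b⟩ lies in the span of the tail of S starting at a
-- while b ∉ S; then, by the exchange lemma, S - a + b is valid for the new order instead (when a
-- was first, S - b + a replaces every S containing b). This injects the tuples of the old order
-- into those of the new one. Once ⟨w⟩ is first, a valid tuple S avoids it and S ∪ {⟨w⟩} is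
-- linearly independent, so S is an n-subset of H with η★(S ∪ {⟨w⟩}) ≥ 1: for n + 1 independent
-- points, all points but the first form a valid tuple. Distinct tuples give distinct subsets.
--
-- Equality of reals is undecidable, so choices (a nonzero coordinate, whether a tuple moves) are
-- made under double negation; this suffices since the conclusion is a decidable inequality in ℕ.

module Submission where

open import Level using (0ℓ)
open import Defs
open import Data.Nat using (ℕ; zero; suc; _≤_; _<_; z≤n; s≤s; _≤?_; _<?_; _≡ᵇ_)
import Data.Nat.Properties as ℕ
open import Data.Bool using (Bool; true; false; if_then_else_)
open import Data.Fin using (Fin; toℕ; fromℕ<) renaming (zero to fz; suc to fs)
open import Data.Fin.Permutation.Components using (transpose; transpose-inverse)
open import Data.Fin.Properties using (suc-injective; _≟_; toℕ<n; toℕ-fromℕ<; toℕ-injective; any?)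
open import Data.Fin.Subset using (Subset; _∈_; _∉_; _⊆_; ∣_∣; ⊤)
open import Data.Fin.Subset.Properties using (⊆-antisym; _∈?_; ∣⊤∣≡n)
open import Data.Unit using (tt) renaming (⊤ to Unit)
open import Data.Vec using ([]; _∷_; here; there; tabulate; _[_]≔_)
open import Data.Vec.Properties using ([]≔-updates; []≔-minimal; []=-injective; lookup⇒[]=; []=⇒lookup; lookup∘tabulate)
open import Data.List using (List; []; _∷_; _++_; map; length; filter; allFin)
open import Data.List.Properties using (length-++; length-map; length-tabulate)
open import Data.Nat.ListAction using (sum)
open import Data.List.Relation.Unary.All as All using (All)
open import Data.List.Relation.Unary.AllPairs using ([]; _∷_)
open import Data.List.Relation.Unary.Any using (here; there)
open import Data.List.Relation.Unary.Unique.Propositional using (Unique)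
import Data.List.Relation.Unary.Unique.Propositional.Properties as Unique
open import Data.List.Membership.Propositional using () renaming (_∈_ to _∈ₗ_)
open import Data.List.Membership.Propositional.Properties
  using (∈-∃++; ∈-map⁺; ∈-map⁻; ∈-++⁺ˡ; ∈-++⁺ʳ; ∈-filter⁺; ∈-allFin)
open import Data.Product using (Σ; ∃; _×_; _,_; proj₁; proj₂)
open import Function using (_∘_)
open import Data.Sum using (_⊎_; inj₁; inj₂)
open import Data.Empty using (⊥; ⊥-elim)
open import Effect.Monad using (RawMonad)
open import Algebra.Bundles using (CommutativeRing)
open import Algebra.Structures using (IsCommutativeRing)
import Algebra.Properties.Ring as RingProperties
import Algebra.Solver.Ring.NaturalCoefficients as NaturalCoefficientsSolver
open import Data.Maybe using (Maybe; just; nothing)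
import Data.Maybe.Properties as Maybe
open import Relation.Nullary using (¬_; Dec; yes; no; does)
open import Relation.Nullary.Negation using (¬¬-Monad)
open import Relation.Nullary.Decidable using (¬?; decidable-stable; dec-true; dec-false; _×-dec_; _⊎-dec_; ¬¬-excluded-middle)
open import Relation.Binary.PropositionalEquality
  using (_≡_; _≢_; refl; sym; trans; cong; cong₂; subst; subst₂; module ≡-Reasoning)

open RawMonad (¬¬-Monad {0ℓ}) using (_>>=_; pure; _<$>_)

¬¬-∀Fin : ∀ {m} {P : Fin m → Set} → (∀ i → ¬ ¬ P i) → ¬ ¬ (∀ i → P i)
¬¬-∀Fin {zero} f = pure (λ ())
¬¬-∀Fin {suc m} {P} f = f fz >>= λ p₀ → ¬¬-∀Fin (λ i → f (fs i)) >>= λ ps →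
  pure λ { fz → p₀ ; (fs i) → ps i }

¬¬-∀∈ : ∀ {A : Set} {P : A → Set} (xs : List A) → (∀ {x} → x ∈ₗ xs → ¬ ¬ P x) → ¬ ¬ (∀ {x} → x ∈ₗ xs → P x)
¬¬-∀∈ [] f = pure λ ()
¬¬-∀∈ (y ∷ ys) f = f (here refl) >>= λ py → ¬¬-∀∈ ys (λ m → f (there m)) >>= λ ps →
  pure λ { (here refl) → py ; (there m) → ps m }

¬¬-≤ : ∀ {m k} → ¬ ¬ (m ≤ k) → m ≤ k
¬¬-≤ {m} {k} = decidable-stable (m ≤? k)

module _ {A B : Set} where

  private
    ∈-delete : ∀ {x y : B} (us vs : List B) → y ∈ₗ us ++ x ∷ vs → y ≢ x → y ∈ₗ us ++ vs
    ∈-delete []       vs (here refl) y≢x = ⊥-elim (y≢x refl)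
    ∈-delete []       vs (there y∈)  y≢x = y∈
    ∈-delete (u ∷ us) vs (here refl) y≢x = here refl
    ∈-delete (u ∷ us) vs (there y∈)  y≢x = there (∈-delete us vs y∈ y≢x)

    length-delete : ∀ {x : B} (us vs : List B) → length (us ++ x ∷ vs) ≡ suc (length (us ++ vs))
    length-delete us vs = trans (length-++ us) (trans (ℕ.+-suc (length us) _) (cong suc (sym (length-++ us))))

  length-≤-by-injection : (R : A → B → Set) {xs : List A} {ys : List B} → Unique xs →
    (∀ {x x' y} → x ∈ₗ xs → x' ∈ₗ xs → R x y → R x' y → x ≡ x') →
    (∀ {x} → x ∈ₗ xs → ∃ λ y → y ∈ₗ ys × R x y) →
    length xs ≤ length ys
  length-≤-by-injection R {[]} _ _ _ = z≤n
  length-≤-by-injection R {x ∷ xs} (x∉xs ∷ uxs) inj tot with tot (here refl)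
  ... | y , y∈ys , Rxy with ∈-∃++ y∈ys
  ... | us , vs , refl = subst (suc (length xs) ≤_) (sym (length-delete us vs))
    (s≤s (length-≤-by-injection R uxs (λ m m' → inj (there m) (there m')) tot′))
    where
    tot′ : ∀ {x'} → x' ∈ₗ xs → ∃ λ y' → y' ∈ₗ us ++ vs × R x' y'
    tot′ m with tot (there m)
    ... | y' , y'∈ , Rx'y' = y' , ∈-delete us vs y'∈ (λ { refl → All.lookup x∉xs m (inj (here refl) (there m) Rxy Rx'y') }) , Rx'y'

length-≡-by-correspondence : ∀ {A B : Set} (R : A → B → Set) {xs : List A} {ys : List B} → Unique xs → Unique ys →
  (∀ {x x' y} → x ∈ₗ xs → x' ∈ₗ xs → R x y → R x' y → x ≡ x') →
  (∀ {x y y'} → y ∈ₗ ys → y' ∈ₗ ys → R x y → R x y' → y ≡ y') →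
  (∀ {x} → x ∈ₗ xs → ∃ λ y → y ∈ₗ ys × R x y) →
  (∀ {y} → y ∈ₗ ys → ∃ λ x → x ∈ₗ xs × R x y) →
  length xs ≡ length ys
length-≡-by-correspondence R uxs uys injective functional total surjective = ℕ.≤-antisym
  (length-≤-by-injection R uxs injective total)
  (length-≤-by-injection (λ y x → R x y) uys functional surjective)

-- Classically an injection from the P-elements to the Q-elements; it is given as a relation
-- because the image of an element is chosen under double negation.
record _≼_ {A B : Set} (P : A → Set) (Q : B → Set) : Set₁ where
  field
    R         : A → B → Set
    total     : ∀ {x} → P x → ¬ ¬ ∃ (R x)
    sound     : ∀ {x y} → R x y → Q y
    injective : ∀ {x x' y} → P x → P x' → R x y → R x' y → x ≡ x'

≼-refl : ∀ {A : Set} {P : A → Set} → P ≼ P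
≼-refl {P = P} = record
  { R = λ x y → x ≡ y × P x
  ; total = λ {x} px → pure (x , refl , px)
  ; sound = λ { (refl , px) → px }
  ; injective = λ { _ _ (refl , _) (refl , _) → refl }
  }

≼-trans : ∀ {A B C : Set} {P : A → Set} {Q : B → Set} {U : C → Set} → P ≼ Q → Q ≼ U → P ≼ U
≼-trans {B = B} f g = record
  { R = λ x z → Σ B λ y → F.R x y × G.R y z
  ; total = λ px → F.total px >>= λ { (y , Rxy) → G.total (F.sound Rxy) >>= λ { (z , Ryz) → pure (z , y , Rxy , Ryz) } }
  ; sound = λ (_ , _ , Ryz) → G.sound Ryz
  ; injective = λ px px' (y , Rxy , Ryz) (y' , Rx'y' , Ry'z) →
      F.injective px px' Rxy (subst (F.R _) (sym (G.injective (F.sound Rxy) (F.sound Rx'y') Ryz Ry'z)) Rx'y')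
  }
  where
  module F = _≼_ f
  module G = _≼_ g

≼-fix-or-move : ∀ {A : Set} {P Q : A → Set} (Moves : A → Set) (f : A → A) →
  (∀ {x} → P x → ¬ Moves x → Q x) →
  (∀ {x} → P x → Moves x → ¬ ¬ Q (f x)) →
  (∀ {x} → P x → Moves x → ¬ P (f x)) →
  (∀ {x x'} → P x → P x' → Moves x → Moves x' → f x ≡ f x' → x ≡ x') →
  P ≼ Q
≼-fix-or-move {A} {P} {Q} Moves f fixed moved f∉P f-injective = record
  { R = Image
  ; total = λ {x} Px → ¬¬-excluded-middle >>= λ
      { (yes Mx) → (λ Qfx → f x , Qfx , inj₂ (Mx , refl)) <$> moved Px Mx
      ; (no ¬Mx) → pure (x , fixed Px ¬Mx , inj₁ (¬Mx , refl)) }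
  ; sound = proj₁
  ; injective = injective
  }
  where
  Image : A → A → Set
  Image x y = Q y × ((¬ Moves x × y ≡ x) ⊎ (Moves x × y ≡ f x))
  injective : ∀ {x x' y} → P x → P x' → Image x y → Image x' y → x ≡ x'
  injective _  _   (_ , inj₁ (_ , y≡x))   (_ , inj₁ (_ , y≡x'))   = trans (sym y≡x) y≡x'
  injective Px Px' (_ , inj₁ (_ , y≡x))   (_ , inj₂ (Mx' , y≡fx')) = ⊥-elim (f∉P Px' Mx' (subst P (trans (sym y≡x) y≡fx') Px))
  injective Px Px' (_ , inj₂ (Mx , y≡fx)) (_ , inj₁ (_ , y≡x'))   = ⊥-elim (f∉P Px Mx (subst P (trans (sym y≡x') y≡fx) Px'))
  injective Px Px' (_ , inj₂ (Mx , y≡fx)) (_ , inj₂ (Mx' , y≡fx')) = f-injective Px Px' Mx Mx' (trans (sym y≡fx) y≡fx')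

≼⇒length≤ : ∀ {A B : Set} {P : A → Set} {Q : B → Set} → P ≼ Q → {xs : List A} {ys : List B} →
  Unique xs → All P xs → (∀ {y} → Q y → y ∈ₗ ys) → length xs ≤ length ys
≼⇒length≤ f {xs} {ys} uxs Pxs Q⊆ys = ¬¬-≤ (choose <$> ¬¬-∀∈ xs (λ m → total (All.lookup Pxs m)))
  where
  open _≼_ f
  choose : (∀ {x} → x ∈ₗ xs → ∃ (R x)) → length xs ≤ length ys
  choose image = length-≤-by-injection R uxs (λ m m' → injective (All.lookup Pxs m) (All.lookup Pxs m'))
    (λ m → let (y , Rxy) = image m in y , Q⊆ys (sound Rxy) , Rxy)

length-filter≤sum : ∀ {A : Set} {P : A → Set} (P? : ∀ x → Dec (P x)) (g : A → ℕ) →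
  (∀ {x} → P x → 1 ≤ g x) → ∀ xs → length (filter P? xs) ≤ sum (map g xs)
length-filter≤sum P? g P⇒1≤g [] = z≤n
length-filter≤sum P? g P⇒1≤g (x ∷ xs) with P? x
... | yes px = ℕ.+-mono-≤ (P⇒1≤g px) (length-filter≤sum P? g P⇒1≤g xs)
... | no _  = ℕ.≤-trans (length-filter≤sum P? g P⇒1≤g xs) (ℕ.m≤n+m _ (g x))

private
  variable
    T : ℕ

members : Subset T → List (Fin T)
members []          = []
members (true ∷ S)  = fz ∷ map fs (members S)
members (false ∷ S) = map fs (members S)

length-members : (S : Subset T) → length (members S) ≡ ∣ S ∣
length-members [] = refl
length-members (true ∷ S)  = cong suc (trans (length-map fs (members S)) (length-members S))
length-members (false ∷ S) = trans (length-map fs (members S)) (length-members S)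

∈members⇒∈ : ∀ {S : Subset T} {i} → i ∈ₗ members S → i ∈ S
∈members⇒∈ {S = true ∷ S} {i = fz} _ = here
∈members⇒∈ {S = true ∷ S} {i = fs i} (there m) with ∈-map⁻ fs m
... | j , m′ , refl = there (∈members⇒∈ m′)
∈members⇒∈ {S = false ∷ S} m with ∈-map⁻ fs m
... | j , m′ , refl = there (∈members⇒∈ m′)

∈⇒∈members : ∀ {S : Subset T} {i} → i ∈ S → i ∈ₗ members S
∈⇒∈members {S = true ∷ S}  here      = here refl
∈⇒∈members {S = true ∷ S}  (there p) = there (∈-map⁺ fs (∈⇒∈members p))
∈⇒∈members {S = false ∷ S} (there p) = ∈-map⁺ fs (∈⇒∈members p)

members-unique : (S : Subset T) → Unique (members S)
members-unique [] = []
members-unique (true ∷ S) = All.tabulate fz∉ ∷ Unique.map⁺ suc-injective (members-unique S)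
  where
  fz∉ : ∀ {i} → i ∈ₗ map fs (members S) → fz ≢ i
  fz∉ m refl with ∈-map⁻ fs m
  ... | _ , _ , ()
members-unique (false ∷ S) = Unique.map⁺ suc-injective (members-unique S)

∈-allSubsets : ∀ {T} (S : Subset T) → S ∈ₗ allSubsets T
∈-allSubsets [] = here refl
∈-allSubsets {suc T} (true ∷ S)  = ∈-++⁺ˡ (∈-map⁺ (true ∷_) (∈-allSubsets S))
∈-allSubsets {suc T} (false ∷ S) = ∈-++⁺ʳ (map (true ∷_) (allSubsets T)) (∈-map⁺ (false ∷_) (∈-allSubsets S))

allSubsets-unique : ∀ T → Unique (allSubsets T)
allSubsets-unique zero = All.[] ∷ []
allSubsets-unique (suc T) =
  Unique.++⁺ (Unique.map⁺ ∷-injectiveʳ (allSubsets-unique T)) (Unique.map⁺ ∷-injectiveʳ (allSubsets-unique T)) disjoint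
  where
  ∷-injectiveʳ : ∀ {b : Bool} {S S' : Subset T} → _≡_ {A = Subset (suc T)} (b ∷ S) (b ∷ S') → S ≡ S'
  ∷-injectiveʳ refl = refl
  disjoint : ∀ {S} → ¬ (S ∈ₗ map (true ∷_) (allSubsets T) × S ∈ₗ map (false ∷_) (allSubsets T))
  disjoint (m , m') with ∈-map⁻ (true ∷_) m | ∈-map⁻ (false ∷_) m'
  ... | _ , _ , refl | _ , _ , ()

subsetOf : {P : Fin T → Set} → (∀ i → Dec (P i)) → Subset T
subsetOf P? = tabulate (λ i → does (P? i))

module _ {P : Fin T → Set} (P? : ∀ i → Dec (P i)) where

  ∈-subsetOf⁺ : ∀ {i} → P i → i ∈ subsetOf P?
  ∈-subsetOf⁺ {i} p = lookup⇒[]= i _ (trans (lookup∘tabulate _ i) (dec-true (P? i) p))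

  ∈-subsetOf⁻ : ∀ {i} → i ∈ subsetOf P? → P i
  ∈-subsetOf⁻ {i} m with P? i | trans (sym (lookup∘tabulate (λ j → does (P? j)) i)) ([]=⇒lookup m)
  ... | yes p | _ = p
  ... | no _  | ()

x∈p[x]≔true : (S : Subset T) (a : Fin T) → a ∈ S [ a ]≔ true
x∈p[x]≔true = []≔-updates

x∉p[x]≔false : (S : Subset T) (a : Fin T) → a ∉ S [ a ]≔ false
x∉p[x]≔false S a m with []=-injective m ([]≔-updates S a)
... | ()

y∈p⇒y∈p[x]≔b : ∀ {S : Subset T} {a i} b → i ≢ a → i ∈ S → i ∈ S [ a ]≔ b
y∈p⇒y∈p[x]≔b {S = S} {a} {i} b = []≔-minimal S i a

y∈p[x]≔b⇒y∈p : ∀ {S : Subset T} {a i b} → i ≢ a → i ∈ S [ a ]≔ b → i ∈ S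
y∈p[x]≔b⇒y∈p {S = _ ∷ S} {a = fz}   {i = fz}   i≢a _         = ⊥-elim (i≢a refl)
y∈p[x]≔b⇒y∈p {S = _ ∷ S} {a = fz}   {i = fs i} i≢a (there p) = there p
y∈p[x]≔b⇒y∈p {S = _ ∷ S} {a = fs a} {i = fz}   i≢a here      = here
y∈p[x]≔b⇒y∈p {S = _ ∷ S} {a = fs a} {i = fs i} i≢a (there p) = there (y∈p[x]≔b⇒y∈p (λ e → i≢a (cong fs e)) p)

∣p[x]≔true∣ : ∀ (S : Subset T) a → a ∉ S → ∣ S [ a ]≔ true ∣ ≡ suc ∣ S ∣
∣p[x]≔true∣ (true ∷ S)  fz     a∉S = ⊥-elim (a∉S here)
∣p[x]≔true∣ (false ∷ S) fz     a∉S = refl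
∣p[x]≔true∣ (true ∷ S)  (fs a) a∉S = cong suc (∣p[x]≔true∣ S a (λ p → a∉S (there p)))
∣p[x]≔true∣ (false ∷ S) (fs a) a∉S = ∣p[x]≔true∣ S a (λ p → a∉S (there p))

∣p[x]≔false∣ : ∀ (S : Subset T) a → a ∈ S → suc ∣ S [ a ]≔ false ∣ ≡ ∣ S ∣
∣p[x]≔false∣ (true ∷ S)  fz     here      = refl
∣p[x]≔false∣ (true ∷ S)  (fs a) (there p) = cong suc (∣p[x]≔false∣ S a p)
∣p[x]≔false∣ (false ∷ S) (fs a) (there p) = ∣p[x]≔false∣ S a p

exchange : Subset T → Fin T → Fin T → Subset T
exchange S x y = (S [ x ]≔ false) [ y ]≔ true

module _ {S : Subset T} {x y : Fin T} where

  y∈exchange : y ∈ exchange S x y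
  y∈exchange = x∈p[x]≔true _ y

  x∉exchange : x ≢ y → x ∉ exchange S x y
  x∉exchange x≢y x∈ = x∉p[x]≔false S x (y∈p[x]≔b⇒y∈p x≢y x∈)

  ∈exchange⁺ : ∀ {i} → i ≢ x → i ∈ S → i ∈ exchange S x y
  ∈exchange⁺ {i} i≢x i∈S with i ≟ y
  ... | yes refl = y∈exchange
  ... | no i≢y   = y∈p⇒y∈p[x]≔b true i≢y (y∈p⇒y∈p[x]≔b false i≢x i∈S)

  ∈exchange⁻ : ∀ {i} → i ≢ y → i ∈ exchange S x y → i ∈ S × i ≢ x
  ∈exchange⁻ {i} i≢y i∈ = y∈p[x]≔b⇒y∈p i≢x i∈′ , i≢x
    where
    i∈′ : i ∈ S [ x ]≔ false
    i∈′ = y∈p[x]≔b⇒y∈p i≢y i∈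
    i≢x : i ≢ x
    i≢x refl = x∉p[x]≔false S x i∈′

  ∣exchange∣ : x ∈ S → y ∉ S → ∣ exchange S x y ∣ ≡ ∣ S ∣
  ∣exchange∣ x∈S y∉S = trans (∣p[x]≔true∣ _ y y∉S′) (∣p[x]≔false∣ S x x∈S)
    where
    y∉S′ : y ∉ S [ x ]≔ false
    y∉S′ y∈ = y∉S (y∈p[x]≔b⇒y∈p (λ { refl → y∉S x∈S }) y∈)

exchange-injective : ∀ {S S' : Subset T} {x y} → x ∈ S → y ∉ S → x ∈ S' → y ∉ S' →
  exchange S x y ≡ exchange S' x y → S ≡ S'
exchange-injective x∈S y∉S x∈S' y∉S' eq = ⊆-antisym (⊆′ x∈S' y∉S eq) (⊆′ x∈S y∉S' (sym eq))
  where
  ⊆′ : ∀ {S S' : Subset T} {x y} → x ∈ S' → y ∉ S → exchange S x y ≡ exchange S' x y → S ⊆ S'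
  ⊆′ {x = x} {y} x∈S' y∉S eq {i} i∈S with i ≟ x | i ≟ y
  ... | yes refl | _        = x∈S'
  ... | no _     | yes refl = ⊥-elim (y∉S i∈S)
  ... | no i≢x   | no i≢y   = proj₁ (∈exchange⁻ i≢y (subst (i ∈_) eq (∈exchange⁺ i≢x i∈S)))

minimal-element : ∀ (ρ : Fin T → ℕ) {P : Fin T → Set} → (∀ i → Dec (P i)) → ∀ {i} → P i →
  ∃ λ l → P l × (∀ {j} → P j → ρ l ≤ ρ j)
minimal-element ρ {P} P? {i} Pi = descend (suc (ρ i)) ℕ.≤-refl Pi
  where
  descend : ∀ bound {i} → ρ i < bound → P i → ∃ λ l → P l × (∀ {j} → P j → ρ l ≤ ρ j)
  descend (suc bound) {i} ρi<bound Pi with any? (λ j → P? j ×-dec (ρ j <? ρ i))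
  ... | yes (j , Pj , ρj<ρi) = descend bound (ℕ.<-≤-trans ρj<ρi (ℕ.≤-pred ρi<bound)) Pj
  ... | no ∄smaller = i , Pi , λ {j} Pj → ℕ.≮⇒≥ (λ ρj<ρi → ∄smaller (j , Pj , ρj<ρi))

module LinearAlgebra (F : RealField) (n : ℕ) where

  open RealField F hiding (_≤ᵣ_)
  open Lin F n
  open IsCommutativeRing isCommutativeRing
    using (+-assoc; +-comm; +-identityˡ; +-identityʳ; -‿inverseʳ; -‿inverseˡ;
           *-assoc; *-comm; *-identityˡ; *-identityʳ; zeroˡ; zeroʳ; distribˡ; distribʳ)

  ring : CommutativeRing 0ℓ 0ℓ
  ring = record { isCommutativeRing = isCommutativeRing }

  open RingProperties (CommutativeRing.ring ring)
    using (-0#≈0#; -‿involutive; -‿+-comm; -‿distribˡ-*; x∙y⁻¹≈ε⇒x≈y)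
  open NaturalCoefficientsSolver (CommutativeRing.commutativeSemiring ring) (λ _ _ → nothing)
    using (solve; _:=_; _:+_; _:*_)

  1≢0 : 1# ≢ 0#
  1≢0 e = 0≢1 (sym e)

  x+y-y≡x : ∀ x y → x + y + - y ≡ x
  x+y-y≡x x y = trans (+-assoc x y (- y)) (trans (cong (x +_) (-‿inverseʳ y)) (+-identityʳ x))

  inv : (x : Carrier) → x ≢ 0# → Carrier
  inv x x≢0 = proj₁ (inverse x x≢0)

  *-inverseʳ : ∀ x x≢0 → x * inv x x≢0 ≡ 1#
  *-inverseʳ x x≢0 = proj₂ (inverse x x≢0)

  *-inverseˡ : ∀ x x≢0 → inv x x≢0 * x ≡ 1#
  *-inverseˡ x x≢0 = trans (*-comm _ x) (*-inverseʳ x x≢0)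

  x*y≡0⇒y≡0 : ∀ x y → x * y ≡ 0# → x ≢ 0# → y ≡ 0#
  x*y≡0⇒y≡0 x y xy≡0 x≢0 = begin
    y                       ≡⟨ sym (*-identityˡ y) ⟩
    1# * y                  ≡⟨ cong (_* y) (sym (*-inverseˡ x x≢0)) ⟩
    (inv x x≢0 * x) * y     ≡⟨ *-assoc _ x y ⟩
    inv x x≢0 * (x * y)     ≡⟨ cong (inv x x≢0 *_) xy≡0 ⟩
    inv x x≢0 * 0#          ≡⟨ zeroʳ _ ⟩
    0#                      ∎
    where open ≡-Reasoning

  sumF-cong : ∀ {T} {f g : Fin T → Carrier} → (∀ i → f i ≡ g i) → sumF f ≡ sumF g
  sumF-cong {zero} f≗g = refl
  sumF-cong {suc T} f≗g = cong₂ _+_ (f≗g fz) (sumF-cong (λ i → f≗g (fs i)))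

  sumF-zero : ∀ {T} {f : Fin T → Carrier} → (∀ i → f i ≡ 0#) → sumF f ≡ 0#
  sumF-zero {zero} f≗0 = refl
  sumF-zero {suc T} f≗0 = trans (cong₂ _+_ (f≗0 fz) (sumF-zero (λ i → f≗0 (fs i)))) (+-identityʳ 0#)

  sumF-+ : ∀ {T} (f g : Fin T → Carrier) → sumF (λ i → f i + g i) ≡ sumF f + sumF g
  sumF-+ {zero} f g = sym (+-identityʳ 0#)
  sumF-+ {suc T} f g = trans (cong (f fz + g fz +_) (sumF-+ (λ i → f (fs i)) (λ i → g (fs i))))
    (solve 4 (λ a b c d → (a :+ b) :+ (c :+ d) := ((a :+ c) :+ (b :+ d))) refl _ _ _ _)

  sumF-*ˡ : ∀ {T} (a : Carrier) (f : Fin T → Carrier) → sumF (λ i → a * f i) ≡ a * sumF f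
  sumF-*ˡ {zero} a f = sym (zeroʳ a)
  sumF-*ˡ {suc T} a f = trans (cong (a * f fz +_) (sumF-*ˡ a (λ i → f (fs i)))) (sym (distribˡ a (f fz) _))

  sumF-neg : ∀ {T} (f : Fin T → Carrier) → sumF (λ i → - f i) ≡ - sumF f
  sumF-neg {zero} f = sym -0#≈0#
  sumF-neg {suc T} f = trans (cong (- f fz +_) (sumF-neg (λ i → f (fs i)))) (-‿+-comm _ _)

  sumF-swap : ∀ {T U} (f : Fin T → Fin U → Carrier) →
    sumF (λ i → sumF (λ j → f i j)) ≡ sumF (λ j → sumF (λ i → f i j))
  sumF-swap {zero} {U} f = sym (sumF-zero {U} (λ j → refl))
  sumF-swap {suc T} f = begin
    sumF (λ j → f fz j) + sumF (λ i → sumF (λ j → f (fs i) j))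
      ≡⟨ cong (sumF (λ j → f fz j) +_) (sumF-swap (λ i j → f (fs i) j)) ⟩
    sumF (λ j → f fz j) + sumF (λ j → sumF (λ i → f (fs i) j))
      ≡⟨ sym (sumF-+ (λ j → f fz j) (λ j → sumF (λ i → f (fs i) j))) ⟩
    sumF (λ j → f fz j + sumF (λ i → f (fs i) j)) ∎
    where open ≡-Reasoning

  sumF-single : ∀ {T} (f : Fin T → Carrier) (i : Fin T) → (∀ j → j ≢ i → f j ≡ 0#) → sumF f ≡ f i
  sumF-single f fz     f≗0 = trans (cong (f fz +_) (sumF-zero (λ j → f≗0 (fs j) (λ ())))) (+-identityʳ _)
  sumF-single f (fs i) f≗0 = trans (cong₂ _+_ (f≗0 fz (λ ())) (sumF-single (λ j → f (fs j)) i (λ j j≢i → f≗0 (fs j) (λ e → j≢i (suc-injective e)))))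
    (+-identityˡ _)

  δ : ∀ {T} → Fin T → Fin T → Carrier
  δ i j with i ≟ j
  ... | yes _ = 1#
  ... | no _  = 0#

  δ-refl : ∀ {T} (i : Fin T) → δ i i ≡ 1#
  δ-refl i with i ≟ i
  ... | yes _  = refl
  ... | no i≢i = ⊥-elim (i≢i refl)

  δ-≢ : ∀ {T} {i j : Fin T} → i ≢ j → δ i j ≡ 0#
  δ-≢ {i = i} {j} i≢j with i ≟ j
  ... | yes i≡j = ⊥-elim (i≢j i≡j)
  ... | no _    = refl

  sumF-δ*ˡ : ∀ {T} (i : Fin T) (f : Fin T → Carrier) → sumF (λ j → δ i j * f j) ≡ f i
  sumF-δ*ˡ i f = trans (sumF-single _ i (λ j j≢i → trans (cong (_* f j) (δ-≢ (λ e → j≢i (sym e)))) (zeroˡ _)))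
                       (trans (cong (_* f i) (δ-refl i)) (*-identityˡ _))

  sumF-*δʳ : ∀ {T} (i : Fin T) (f : Fin T → Carrier) → sumF (λ j → f j * δ j i) ≡ f i
  sumF-*δʳ i f = trans (sumF-single _ i (λ j j≢i → trans (cong (f j *_) (δ-≢ j≢i)) (zeroʳ _)))
                       (trans (cong (f i *_) (δ-refl i)) (*-identityʳ _))

  sumF-*δˡ : ∀ {T} (i : Fin T) (f : Fin T → Carrier) → sumF (λ j → f j * δ i j) ≡ f i
  sumF-*δˡ i f = trans (sumF-single _ i (λ j j≢i → trans (cong (f j *_) (δ-≢ (λ e → j≢i (sym e)))) (zeroʳ _)))
                       (trans (cong (f i *_) (δ-refl i)) (*-identityʳ _))

  update : ∀ {T} → (Fin T → Carrier) → Fin T → Carrier → Fin T → Carrier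
  update f a x i with i ≟ a
  ... | yes _ = x
  ... | no _  = f i

  update-other : ∀ {T} (f : Fin T → Carrier) {a i} x → i ≢ a → update f a x i ≡ f i
  update-other f {a} {i} x i≢a with i ≟ a
  ... | yes i≡a = ⊥-elim (i≢a i≡a)
  ... | no _    = refl

  sumF-split : ∀ {T} (f : Fin T → Carrier) a → sumF f ≡ f a + sumF (update f a 0#)
  sumF-split f a = begin
    sumF f                                            ≡⟨ sumF-cong split ⟩
    sumF (λ i → δ a i * f a + update f a 0# i)        ≡⟨ sumF-+ (λ i → δ a i * f a) (update f a 0#) ⟩
    sumF (λ i → δ a i * f a) + sumF (update f a 0#)   ≡⟨ cong (_+ sumF (update f a 0#)) (sumF-δ*ˡ a (λ _ → f a)) ⟩
    f a + sumF (update f a 0#)                        ∎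
    where
    open ≡-Reasoning
    split : ∀ i → f i ≡ δ a i * f a + update f a 0# i
    split i with i ≟ a
    ... | yes refl = sym (trans (cong (_+ 0#) (trans (cong (_* f i) (δ-refl i)) (*-identityˡ _))) (+-identityʳ _))
    ... | no i≢a   = sym (trans (cong (_+ f i) (trans (cong (_* f a) (δ-≢ (λ e → i≢a (sym e)))) (zeroˡ _))) (+-identityˡ _))

  dot : V → V → Carrier
  dot u v = sumF (λ k → u k * v k)

  dot-cong : ∀ u {v v'} → (∀ k → v k ≡ v' k) → dot u v ≡ dot u v'
  dot-cong u v≗v' = sumF-cong (λ k → cong (u k *_) (v≗v' k))

  dot-zeroʳ : ∀ u → dot u (λ _ → 0#) ≡ 0#
  dot-zeroʳ u = sumF-zero (λ k → zeroʳ (u k))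

  dot-*ˡ : ∀ a u v → dot (λ m → a * u m) v ≡ a * dot u v
  dot-*ˡ a u v = trans (sumF-cong (λ m → *-assoc a (u m) (v m))) (sumF-*ˡ a (λ m → u m * v m))

  dot-*ʳ : ∀ a u v → dot u (λ m → a * v m) ≡ a * dot u v
  dot-*ʳ a u v = trans (sumF-cong (λ m → solve 3 (λ x y z → y :* (x :* z) := x :* (y :* z)) refl a (u m) (v m)))
                       (sumF-*ˡ a (λ m → u m * v m))

  dot-sub-*ˡ : ∀ u u' a v → dot (λ m → u m + - (a * u' m)) v ≡ dot u v + - (a * dot u' v)
  dot-sub-*ˡ u u' a v = begin
    sumF (λ m → (u m + - (a * u' m)) * v m)       ≡⟨ sumF-cong (λ m → expand (u m) (u' m) (v m)) ⟩
    sumF (λ m → u m * v m + - (a * (u' m * v m)))  ≡⟨ sumF-+ (λ m → u m * v m) (λ m → - (a * (u' m * v m))) ⟩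
    dot u v + sumF (λ m → - (a * (u' m * v m)))    ≡⟨ cong (dot u v +_) (trans (sumF-neg (λ m → a * (u' m * v m))) (cong -_ (sumF-*ˡ a (λ m → u' m * v m)))) ⟩
    dot u v + - (a * dot u' v)                     ∎
    where
    open ≡-Reasoning
    expand : ∀ x y z → (x + - (a * y)) * z ≡ x * z + - (a * (y * z))
    expand x y z = trans (distribʳ z x (- (a * y))) (cong (x * z +_) (trans (sym (-‿distribˡ-* (a * y) z)) (cong -_ (*-assoc a y z))))

  dot-lincomb : ∀ {T} u (H : Fin T → V) c → dot u (lincomb H c) ≡ sumF (λ i → c i * dot u (H i))
  dot-lincomb u H c = begin
    sumF (λ k → u k * sumF (λ i → c i * H i k))    ≡⟨ sumF-cong (λ k → sym (sumF-*ˡ (u k) (λ i → c i * H i k))) ⟩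
    sumF (λ k → sumF (λ i → u k * (c i * H i k)))  ≡⟨ sumF-swap (λ k i → u k * (c i * H i k)) ⟩
    sumF (λ i → sumF (λ k → u k * (c i * H i k)))  ≡⟨ sumF-cong (λ i → trans (sumF-cong (λ k → swap (u k) (c i) (H i k))) (sumF-*ˡ (c i) (λ k → u k * H i k))) ⟩
    sumF (λ i → c i * dot u (H i))                 ∎
    where
    open ≡-Reasoning
    swap : ∀ x y z → x * (y * z) ≡ y * (x * z)
    swap = solve 3 (λ x y z → x :* (y :* z) := y :* (x :* z)) refl

  proportional-refl : ∀ v → Proportional v v
  proportional-refl v = 1# , λ k → sym (*-identityˡ _)

  proportional-trans : ∀ {u v w} → Proportional u v → Proportional v w → Proportional u w
  proportional-trans (a , u≗av) (b , v≗bw) = a * b , λ k → trans (u≗av k) (trans (cong (a *_) (v≗bw k)) (sym (*-assoc a b _)))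

  proportional-factor≢0 : ∀ {v u} → NonZeroV v → (p : Proportional v u) → proj₁ p ≢ 0#
  proportional-factor≢0 v≢0 (a , v≗au) a≡0 = v≢0 (λ k → trans (v≗au k) (trans (cong (_* _) a≡0) (zeroˡ _)))

  proportional-sym : ∀ {v u} → NonZeroV v → Proportional v u → Proportional u v
  proportional-sym {v} {u} v≢0 (a , v≗au) = inv a a≢0 , λ k → sym (begin
    inv a a≢0 * v k          ≡⟨ cong (inv a a≢0 *_) (v≗au k) ⟩
    inv a a≢0 * (a * u k)    ≡⟨ sym (*-assoc _ a _) ⟩
    (inv a a≢0 * a) * u k    ≡⟨ cong (_* u k) (*-inverseˡ a a≢0) ⟩
    1# * u k                 ≡⟨ *-identityˡ _ ⟩
    u k                      ∎)
    where
    open ≡-Reasoning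
    a≢0 : a ≢ 0#
    a≢0 = proportional-factor≢0 v≢0 (a , v≗au)

  module _ {T : ℕ} (H : Fin T → V) where

    lincomb-+ : ∀ c d k → lincomb H (λ i → c i + d i) k ≡ lincomb H c k + lincomb H d k
    lincomb-+ c d k = trans (sumF-cong (λ i → distribʳ (H i k) (c i) (d i))) (sumF-+ (λ i → c i * H i k) (λ i → d i * H i k))

    lincomb-*ˡ : ∀ a c k → lincomb H (λ i → a * c i) k ≡ a * lincomb H c k
    lincomb-*ˡ a c k = trans (sumF-cong (λ i → *-assoc a (c i) (H i k))) (sumF-*ˡ a (λ i → c i * H i k))

    lincomb-δ : ∀ e k → lincomb H (δ e) k ≡ H e k
    lincomb-δ e k = sumF-δ*ˡ e (λ i → H i k)

    lincomb-zero : ∀ {c} → (∀ i → c i ≡ 0#) → ∀ k → lincomb H c k ≡ 0#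
    lincomb-zero c≗0 k = sumF-zero (λ i → trans (cong (_* H i k) (c≗0 i)) (zeroˡ _))

    lincomb-neg : ∀ c k → lincomb H (λ i → - c i) k ≡ - lincomb H c k
    lincomb-neg c k = trans (sumF-cong (λ i → sym (-‿distribˡ-* (c i) (H i k)))) (sumF-neg (λ i → c i * H i k))

    lincomb-sub : ∀ c d k → lincomb H (λ i → c i + - d i) k ≡ lincomb H c k + - lincomb H d k
    lincomb-sub c d k = trans (lincomb-+ c (λ i → - d i) k) (cong (lincomb H c k +_) (lincomb-neg d k))

    lincomb-split : ∀ c a k → lincomb H c k ≡ c a * H a k + lincomb H (update c a 0#) k
    lincomb-split c a k = trans (sumF-split (λ i → c i * H i k) a) (cong (c a * H a k +_) (sumF-cong drop-a))
      where
      drop-a : ∀ i → update (λ i → c i * H i k) a 0# i ≡ update c a 0# i * H i k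
      drop-a i with i ≟ a
      ... | yes _ = sym (zeroˡ _)
      ... | no _  = refl

    span-mono : ∀ {Q Q' : Fin T → Set} {v} → (∀ {i} → Q i → Q' i) → InSpanOf H Q v → InSpanOf H Q' v
    span-mono Q⊆Q' (c , c∣Q , v≡Hc) = c , (λ i ¬Q'i → c∣Q i (λ Qi → ¬Q'i (Q⊆Q' Qi))) , v≡Hc

    generator∈span : ∀ {Q : Fin T → Set} {e} → Q e → InSpanOf H Q (H e)
    generator∈span {Q} {e} Qe = δ e , (λ i ¬Qi → δ-≢ (λ e≡i → ¬Qi (subst Q e≡i Qe))) , (λ k → sym (lincomb-δ e k))

    span-trans : ∀ {Q Q' : Fin T → Set} {v} → (∀ i → Dec (Q i)) →
      (∀ {i} → Q i → InSpanOf H Q' (H i)) → InSpanOf H Q v → InSpanOf H Q' v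
    span-trans {Q} {Q'} {v} Q? Q⊆spanQ' (c , c∣Q , v≡Hc) = e , e∣Q' , v≡He
      where
      d : Fin T → Fin T → Carrier
      d i with Q? i
      ... | yes Qi = proj₁ (Q⊆spanQ' Qi)
      ... | no _   = λ _ → 0#
      e : Fin T → Carrier
      e j = sumF (λ i → c i * d i j)
      e∣Q' : ∀ j → ¬ Q' j → e j ≡ 0#
      e∣Q' j ¬Q'j = sumF-zero vanish
        where
        vanish : ∀ i → c i * d i j ≡ 0#
        vanish i with Q? i
        ... | yes Qi  = trans (cong (c i *_) (proj₁ (proj₂ (Q⊆spanQ' Qi)) j ¬Q'j)) (zeroʳ _)
        ... | no ¬Qi = trans (cong (_* _) (c∣Q i ¬Qi)) (zeroˡ _)
      expand : ∀ k i → c i * H i k ≡ c i * lincomb H (d i) k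
      expand k i with Q? i
      ... | yes Qi  = cong (c i *_) (proj₂ (proj₂ (Q⊆spanQ' Qi)) k)
      ... | no ¬Qi = trans (cong (_* H i k) (c∣Q i ¬Qi)) (trans (zeroˡ _) (sym (trans (cong (_* lincomb H (λ _ → 0#) k) (c∣Q i ¬Qi)) (zeroˡ _))))
      v≡He : ∀ k → v k ≡ lincomb H e k
      v≡He k = begin
        v k                                                ≡⟨ v≡Hc k ⟩
        sumF (λ i → c i * H i k)                           ≡⟨ sumF-cong (expand k) ⟩
        sumF (λ i → c i * sumF (λ j → d i j * H j k))      ≡⟨ sumF-cong (λ i → sym (sumF-*ˡ (c i) (λ j → d i j * H j k))) ⟩
        sumF (λ i → sumF (λ j → c i * (d i j * H j k)))    ≡⟨ sumF-swap (λ i j → c i * (d i j * H j k)) ⟩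
        sumF (λ j → sumF (λ i → c i * (d i j * H j k)))    ≡⟨ sumF-cong column ⟩
        sumF (λ j → e j * H j k)                           ∎
        where
        open ≡-Reasoning
        column : ∀ j → sumF (λ i → c i * (d i j * H j k)) ≡ e j * H j k
        column j = trans (sumF-cong (λ i → trans (sym (*-assoc (c i) (d i j) (H j k))) (*-comm _ (H j k))))
                   (trans (sumF-*ˡ (H j k) (λ i → c i * d i j)) (*-comm (H j k) (e j)))

    IndependentOn : (Fin T → Set) → Set
    IndependentOn Q = ∀ c → (∀ i → ¬ Q i → c i ≡ 0#) → (∀ k → lincomb H c k ≡ 0#) → ∀ i → c i ≡ 0#

    independent-mono : ∀ {Q Q' : Fin T → Set} → (∀ {i} → Q' i → Q i) → IndependentOn Q → IndependentOn Q'
    independent-mono Q'⊆Q indQ c c∣Q' Hc≡0 = indQ c (λ i ¬Qi → c∣Q' i (λ Q'i → ¬Qi (Q'⊆Q Q'i))) Hc≡0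

    independent⇒∉span : ∀ {Q Q' : Fin T → Set} {e} → IndependentOn Q → Q e → (∀ {i} → Q' i → Q i) → ¬ Q' e →
      ¬ InSpanOf H Q' (H e)
    independent⇒∉span {Q} {Q'} {e} indQ Qe Q'⊆Q ¬Q'e (d , d∣Q' , He≡Hd) = 1≢0 (begin
      1#               ≡⟨ sym (-‿involutive 1#) ⟩
      - - 1#           ≡⟨ cong -_ (sym (+-identityˡ (- 1#))) ⟩
      - (0# + - 1#)    ≡⟨ cong₂ (λ x y → - (x + - y)) (sym (d∣Q' e ¬Q'e)) (sym (δ-refl e)) ⟩
      - c e            ≡⟨ cong -_ (indQ c c∣Q Hc≡0 e) ⟩
      - 0#             ≡⟨ -0#≈0# ⟩
      0#               ∎)
      where
      open ≡-Reasoning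
      c : Fin T → Carrier
      c i = d i + - δ e i
      c∣Q : ∀ i → ¬ Q i → c i ≡ 0#
      c∣Q i ¬Qi = trans (cong₂ (λ x y → x + - y) (d∣Q' i (λ Q'i → ¬Qi (Q'⊆Q Q'i))) (δ-≢ (λ e≡i → ¬Qi (subst Q e≡i Qe))))
                        (trans (+-identityˡ _) -0#≈0#)
      Hc≡0 : ∀ k → lincomb H c k ≡ 0#
      Hc≡0 k = trans (lincomb-sub d (δ e) k)
        (trans (cong₂ (λ x y → x + - y) (sym (He≡Hd k)) (lincomb-δ e k)) (-‿inverseʳ (H e k)))

    span-exchange : ∀ {Q : Fin T → Set} {a b} (d : Fin T → Carrier) → Q a → ¬ Q b →
      (∀ i → ¬ Q i → d i ≡ 0#) → (∀ k → H b k ≡ lincomb H d k) → d a ≢ 0# →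
      InSpanOf H (λ i → (Q i × i ≢ a) ⊎ i ≡ b) (H a)
    span-exchange {Q} {a} {b} d Qa ¬Qb d∣Q Hb≡Hd da≢0 = e , e∣Q′ , Ha≡He
      where
      ι : Carrier
      ι = inv (d a) da≢0
      d′ : Fin T → Carrier
      d′ = update d a 0#
      e : Fin T → Carrier
      e i = ι * (δ b i + - d′ i)
      e∣Q′ : ∀ i → ¬ ((Q i × i ≢ a) ⊎ i ≡ b) → e i ≡ 0#
      e∣Q′ i ¬Q′i = trans (cong₂ (λ x y → ι * (x + - y)) (δ-≢ (λ b≡i → ¬Q′i (inj₂ (sym b≡i)))) d′i≡0)
                          (trans (cong (λ z → ι * (0# + z)) -0#≈0#) (trans (cong (ι *_) (+-identityʳ 0#)) (zeroʳ ι)))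
        where
        d′i≡0 : d′ i ≡ 0#
        d′i≡0 with i ≟ a
        ... | yes _  = refl
        ... | no i≢a = d∣Q i (λ Qi → ¬Q′i (inj₁ (Qi , i≢a)))
      Ha≡He : ∀ k → H a k ≡ lincomb H e k
      Ha≡He k = sym (begin
        lincomb H e k                                   ≡⟨ lincomb-*ˡ ι (λ i → δ b i + - d′ i) k ⟩
        ι * lincomb H (λ i → δ b i + - d′ i) k          ≡⟨ cong (ι *_) (lincomb-sub (δ b) d′ k) ⟩
        ι * (lincomb H (δ b) k + - lincomb H d′ k)      ≡⟨ cong (λ z → ι * (z + - lincomb H d′ k)) Hb-split ⟩
        ι * (d a * H a k + lincomb H d′ k + - lincomb H d′ k) ≡⟨ cong (ι *_) (x+y-y≡x _ _) ⟩
        ι * (d a * H a k)                               ≡⟨ sym (*-assoc ι (d a) (H a k)) ⟩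
        (ι * d a) * H a k                               ≡⟨ cong (_* H a k) (*-inverseˡ (d a) da≢0) ⟩
        1# * H a k                                      ≡⟨ *-identityˡ _ ⟩
        H a k                                           ∎)
        where
        open ≡-Reasoning
        Hb-split : lincomb H (δ b) k ≡ d a * H a k + lincomb H d′ k
        Hb-split = trans (lincomb-δ b k) (trans (Hb≡Hd k) (lincomb-split d a k))

    DualBasisOn : (Fin T → Set) → Set
    DualBasisOn Q = Σ (Fin T → V) λ φ → ∀ {i j} → Q i → Q j → dot (φ i) (H j) ≡ δ i j

    dualBasis-mono : ∀ {Q Q' : Fin T → Set} → (∀ {i} → Q' i → Q i) → DualBasisOn Q → DualBasisOn Q'
    dualBasis-mono Q'⊆Q (φ , φ-dual) = φ , λ Q'i Q'j → φ-dual (Q'⊆Q Q'i) (Q'⊆Q Q'j)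

    dualBasis⇒independent : ∀ {Q : Fin T → Set} → (∀ i → Dec (Q i)) → DualBasisOn Q → IndependentOn Q
    dualBasis⇒independent {Q} Q? (φ , φ-dual) c c∣Q Hc≡0 i with Q? i
    ... | no ¬Qi = c∣Q i ¬Qi
    ... | yes Qi = begin
      c i                                 ≡⟨ sym (sumF-*δˡ i c) ⟩
      sumF (λ j → c j * δ i j)            ≡⟨ sumF-cong coefficient ⟩
      sumF (λ j → c j * dot (φ i) (H j))  ≡⟨ sym (dot-lincomb (φ i) H c) ⟩
      dot (φ i) (lincomb H c)             ≡⟨ dot-cong (φ i) Hc≡0 ⟩
      dot (φ i) (λ _ → 0#)                ≡⟨ dot-zeroʳ (φ i) ⟩
      0#                                  ∎
      where
      open ≡-Reasoning
      coefficient : ∀ j → c j * δ i j ≡ c j * dot (φ i) (H j)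
      coefficient j with Q? j
      ... | yes Qj  = cong (c j *_) (sym (φ-dual Qi Qj))
      ... | no ¬Qj = trans (cong (_* δ i j) (c∣Q j ¬Qj)) (trans (zeroˡ _) (sym (trans (cong (_* dot (φ i) (H j)) (c∣Q j ¬Qj)) (zeroˡ _))))

    module _ {Q : Fin T → Set} (Q? : ∀ i → Dec (Q i)) (φ : Fin T → V)
             (φ-dual : ∀ {i j} → Q i → Q j → dot (φ i) (H j) ≡ δ i j) where

      private
        restrict : (Fin T → Carrier) → Fin T → Carrier
        restrict f i with Q? i
        ... | yes _ = f i
        ... | no _  = 0#

        restrict-∈ : ∀ f {i} → Q i → restrict f i ≡ f i
        restrict-∈ f {i} Qi with Q? i
        ... | yes _  = refl
        ... | no ¬Qi = ⊥-elim (¬Qi Qi)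

        restrict-∉ : ∀ f {i} → ¬ Q i → restrict f i ≡ 0#
        restrict-∉ f {i} ¬Qi with Q? i
        ... | yes Qi = ⊥-elim (¬Qi Qi)
        ... | no _   = refl

        restrict-*-comm : ∀ f g i → restrict f i * g i ≡ restrict g i * f i
        restrict-*-comm f g i with Q? i
        ... | yes _ = *-comm _ _
        ... | no _  = trans (zeroˡ _) (sym (zeroˡ _))

        restrict-*-dual : ∀ f {j} → Q j → ∀ i → restrict f i * dot (φ i) (H j) ≡ restrict f i * δ i j
        restrict-*-dual f Qj i with Q? i
        ... | yes Qi = cong (f i *_) (φ-dual Qi Qj)
        ... | no _   = trans (zeroˡ _) (sym (zeroˡ _))

      residual : Fin T → V
      residual e k = H e k + - lincomb H (restrict (λ i → dot (φ i) (H e))) k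

      -- π k · v is the k-th coordinate of v minus that of its projection Σ_{i∈Q} (φ i · v) H i onto span Q.
      π : Fin (suc n) → V
      π k m = δ k m + - sumF (λ i → restrict (λ i → H i k) i * φ i m)

      dot-π : ∀ k v → dot (π k) v ≡ v k + - sumF (λ i → restrict (λ i → H i k) i * dot (φ i) v)
      dot-π k v = begin
        sumF (λ m → (δ k m + - sumF (λ i → β i * φ i m)) * v m)
          ≡⟨ sumF-cong (λ m → trans (distribʳ (v m) (δ k m) _) (cong (δ k m * v m +_) (sym (-‿distribˡ-* (sumF (λ i → β i * φ i m)) (v m))))) ⟩
        sumF (λ m → δ k m * v m + - (sumF (λ i → β i * φ i m) * v m))
          ≡⟨ sumF-+ (λ m → δ k m * v m) (λ m → - (sumF (λ i → β i * φ i m) * v m)) ⟩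
        sumF (λ m → δ k m * v m) + sumF (λ m → - (sumF (λ i → β i * φ i m) * v m))
          ≡⟨ cong₂ _+_ (sumF-δ*ˡ k v) (trans (sumF-neg (λ m → sumF (λ i → β i * φ i m) * v m)) (cong -_ regroup)) ⟩
        v k + - sumF (λ i → β i * dot (φ i) v) ∎
        where
        open ≡-Reasoning
        β : Fin T → Carrier
        β = restrict (λ i → H i k)
        rotate : ∀ x y z → x * (y * z) ≡ y * (z * x)
        rotate = solve 3 (λ x y z → x :* (y :* z) := y :* (z :* x)) refl
        regroup : sumF (λ m → sumF (λ i → β i * φ i m) * v m) ≡ sumF (λ i → β i * dot (φ i) v)
        regroup = begin
          sumF (λ m → sumF (λ i → β i * φ i m) * v m)
            ≡⟨ sumF-cong (λ m → trans (*-comm _ (v m)) (sym (sumF-*ˡ (v m) (λ i → β i * φ i m)))) ⟩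
          sumF (λ m → sumF (λ i → v m * (β i * φ i m)))
            ≡⟨ sumF-swap (λ m i → v m * (β i * φ i m)) ⟩
          sumF (λ i → sumF (λ m → v m * (β i * φ i m)))
            ≡⟨ sumF-cong (λ i → trans (sumF-cong (λ m → rotate (v m) (β i) (φ i m))) (sumF-*ˡ (β i) (λ m → φ i m * v m))) ⟩
          sumF (λ i → β i * dot (φ i) v) ∎

      π-annihilates : ∀ k {j} → Q j → dot (π k) (H j) ≡ 0#
      π-annihilates k {j} Qj = trans (dot-π k (H j)) (trans (cong (λ z → H j k + - z) projection) (-‿inverseʳ (H j k)))
        where
        projection : sumF (λ i → restrict (λ i → H i k) i * dot (φ i) (H j)) ≡ H j k
        projection = trans (sumF-cong (restrict-*-dual _ Qj)) (trans (sumF-*δʳ j _) (restrict-∈ _ Qj))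

      π-residual : ∀ k e → dot (π k) (H e) ≡ residual e k
      π-residual k e = trans (dot-π k (H e)) (cong (λ z → H e k + - z) (sumF-cong (restrict-*-comm _ _)))

      ¬¬-residual≢0 : ∀ {e} → ¬ InSpanOf H Q (H e) → ¬ ¬ ∃ λ k → residual e k ≢ 0#
      ¬¬-residual≢0 {e} He∉spanQ ∄k = ¬¬-∀Fin (λ k rₖ≢0 → ∄k (k , rₖ≢0))
        (λ r≡0 → He∉spanQ (_ , (λ i → restrict-∉ _) , (λ k → x∙y⁻¹≈ε⇒x≈y _ _ (r≡0 k))))

      ¬¬-separating-functional : ∀ {e} → ¬ InSpanOf H Q (H e) →
        ¬ ¬ ∃ λ ψ → (∀ {j} → Q j → dot ψ (H j) ≡ 0#) × dot ψ (H e) ≡ 1#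
      ¬¬-separating-functional {e} He∉spanQ = separating <$> ¬¬-residual≢0 He∉spanQ
        where
        separating : (∃ λ k → residual e k ≢ 0#) → ∃ λ ψ → (∀ {j} → Q j → dot ψ (H j) ≡ 0#) × dot ψ (H e) ≡ 1#
        separating (k , rₖ≢0) = (λ m → r⁻¹ * π k m) , ψ-Q , ψ-e
          where
          r⁻¹ : Carrier
          r⁻¹ = inv (residual e k) rₖ≢0
          ψ-Q : ∀ {j} → Q j → dot (λ m → r⁻¹ * π k m) (H j) ≡ 0#
          ψ-Q {j} Qj = trans (dot-*ˡ r⁻¹ (π k) (H j)) (trans (cong (r⁻¹ *_) (π-annihilates k Qj)) (zeroʳ r⁻¹))
          ψ-e : dot (λ m → r⁻¹ * π k m) (H e) ≡ 1#
          ψ-e = trans (dot-*ˡ r⁻¹ (π k) (H e)) (trans (cong (r⁻¹ *_) (π-residual k e)) (*-inverseˡ (residual e k) rₖ≢0))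

      dualBasis-extend : ∀ {e} → ¬ Q e → (ψ : V) → (∀ {j} → Q j → dot ψ (H j) ≡ 0#) → dot ψ (H e) ≡ 1# →
        DualBasisOn (λ i → Q i ⊎ i ≡ e)
      dualBasis-extend {e} ¬Qe ψ ψ-Q ψ-e = φ′ , φ′-dual
        where
        φ′ : Fin T → V
        φ′ i with i ≟ e
        ... | yes _ = ψ
        ... | no _  = λ m → φ i m + - (dot (φ i) (H e) * ψ m)
        φ′-e : ∀ v → dot (φ′ e) v ≡ dot ψ v
        φ′-e v with e ≟ e
        ... | yes _  = refl
        ... | no e≢e = ⊥-elim (e≢e refl)
        φ′-≢ : ∀ {i} v → i ≢ e → dot (φ′ i) v ≡ dot (φ i) v + - (dot (φ i) (H e) * dot ψ v)
        φ′-≢ {i} v i≢e with i ≟ e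
        ... | yes i≡e = ⊥-elim (i≢e i≡e)
        ... | no _    = dot-sub-*ˡ (φ i) ψ (dot (φ i) (H e)) v
        Q⇒≢e : ∀ {i} → Q i → i ≢ e
        Q⇒≢e Qi refl = ¬Qe Qi
        φ′-dual : ∀ {i j} → Q i ⊎ i ≡ e → Q j ⊎ j ≡ e → dot (φ′ i) (H j) ≡ δ i j
        φ′-dual {i} {j} (inj₁ Qi) (inj₁ Qj) = trans (φ′-≢ (H j) (Q⇒≢e Qi))
          (trans (cong₂ (λ x y → x + - (dot (φ i) (H e) * y)) (φ-dual Qi Qj) (ψ-Q Qj))
          (trans (cong (λ z → δ i j + - z) (zeroʳ _)) (trans (cong (δ i j +_) -0#≈0#) (+-identityʳ _))))
        φ′-dual {i} (inj₁ Qi) (inj₂ refl) = trans (φ′-≢ (H e) (Q⇒≢e Qi))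
          (trans (cong (λ y → dot (φ i) (H e) + - (dot (φ i) (H e) * y)) ψ-e)
          (trans (cong (λ z → dot (φ i) (H e) + - z) (*-identityʳ _)) (trans (-‿inverseʳ _) (sym (δ-≢ (Q⇒≢e Qi))))))
        φ′-dual {j = j} (inj₂ refl) (inj₁ Qj) = trans (φ′-e (H j)) (trans (ψ-Q Qj) (sym (δ-≢ (λ e≡j → Q⇒≢e Qj (sym e≡j)))))
        φ′-dual (inj₂ refl) (inj₂ refl) = trans (φ′-e (H e)) (trans ψ-e (sym (δ-refl e)))

    independent⇒¬¬dualBasis : ∀ {Q : Fin T → Set} → (∀ i → Dec (Q i)) → IndependentOn Q → ¬ ¬ DualBasisOn Q
    independent⇒¬¬dualBasis {Q} Q? indQ = dualBasis-mono (λ {i} Qi → Qi , toℕ<n i) <$> prefix T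
      where
      Below : ℕ → Fin T → Set
      Below m i = Q i × toℕ i < m
      prefix : ∀ m → ¬ ¬ DualBasisOn (Below m)
      prefix zero    = pure ((λ _ _ → 0#) , λ { (_ , ()) _ })
      prefix (suc m) = prefix m >>= step
        where
        step : DualBasisOn (Below m) → ¬ ¬ DualBasisOn (Below (suc m))
        step (φ , φ-dual) with m <? T
        ... | no m≮T = pure (dualBasis-mono (λ {i} (Qi , _) → Qi , ℕ.<-≤-trans (toℕ<n i) (ℕ.≮⇒≥ m≮T)) (φ , φ-dual))
        ... | yes m<T with Q? (fromℕ< m<T)
        ...   | yes Qe = extend <$> ¬¬-separating-functional Below? φ φ-dual He∉span
          where
          e = fromℕ< m<T
          Below? : ∀ i → Dec (Below m i)
          Below? i = Q? i ×-dec (toℕ i <? m)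
          ¬Below-e : ¬ Below m e
          ¬Below-e (_ , e<m) = ℕ.<-irrefl (toℕ-fromℕ< m<T) e<m
          He∉span : ¬ InSpanOf H (Below m) (H e)
          He∉span = independent⇒∉span indQ Qe proj₁ ¬Below-e
          split : ∀ {i} → Below (suc m) i → Below m i ⊎ i ≡ e
          split {i} (Qi , i<1+m) with ℕ.m<1+n⇒m<n∨m≡n i<1+m
          ... | inj₁ i<m = inj₁ (Qi , i<m)
          ... | inj₂ i≡m = inj₂ (toℕ-injective (trans i≡m (sym (toℕ-fromℕ< m<T))))
          extend : (∃ λ ψ → (∀ {j} → Below m j → dot ψ (H j) ≡ 0#) × dot ψ (H e) ≡ 1#) → DualBasisOn (Below (suc m))
          extend (ψ , ψ-Q , ψ-e) = dualBasis-mono split (dualBasis-extend Below? φ φ-dual ¬Below-e ψ ψ-Q ψ-e)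
        ...   | no ¬Qe = pure (dualBasis-mono below (φ , φ-dual))
          where
          below : ∀ {i} → Below (suc m) i → Below m i
          below {i} (Qi , i<1+m) with ℕ.m<1+n⇒m<n∨m≡n i<1+m
          ... | inj₁ i<m = Qi , i<m
          ... | inj₂ i≡m = ⊥-elim (¬Qe (subst Q (toℕ-injective (trans i≡m (sym (toℕ-fromℕ< m<T)))) Qi))

    independent-extend : ∀ {Q : Fin T → Set} {e} → (∀ i → Dec (Q i)) → IndependentOn Q → ¬ Q e →
      ¬ InSpanOf H Q (H e) → ¬ ¬ IndependentOn (λ i → Q i ⊎ i ≡ e)
    independent-extend {Q} {e} Q? indQ ¬Qe He∉span =
      independent⇒¬¬dualBasis Q? indQ >>= λ (φ , φ-dual) →
      ¬¬-separating-functional Q? φ φ-dual He∉span >>= λ (ψ , ψ-Q , ψ-e) →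
      pure (dualBasis⇒independent (λ i → Q? i ⊎-dec (i ≟ e)) (dualBasis-extend Q? φ φ-dual ¬Qe ψ ψ-Q ψ-e))

    independent-exchange : ∀ {Q : Fin T → Set} {a b} (d : Fin T → Carrier) → IndependentOn Q → Q a → ¬ Q b →
      (∀ i → ¬ Q i → d i ≡ 0#) → (∀ k → H b k ≡ lincomb H d k) → d a ≢ 0# →
      IndependentOn (λ i → (Q i × i ≢ a) ⊎ i ≡ b)
    independent-exchange {Q} {a} {b} d indQ Qa ¬Qb d∣Q Hb≡Hd da≢0 c c∣Q′ Hc≡0 = c≡0
      where
      a≢b : a ≢ b
      a≢b refl = ¬Qb Qa
      c′ : Fin T → Carrier
      c′ = update c b 0#
      e : Fin T → Carrier
      e i = c′ i + c b * d i
      e∣Q : ∀ i → ¬ Q i → e i ≡ 0#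
      e∣Q i ¬Qi = trans (cong₂ _+_ c′i≡0 (trans (cong (c b *_) (d∣Q i ¬Qi)) (zeroʳ _))) (+-identityˡ 0#)
        where
        c′i≡0 : c′ i ≡ 0#
        c′i≡0 with i ≟ b
        ... | yes _  = refl
        ... | no i≢b = c∣Q′ i λ { (inj₁ (Qi , _)) → ¬Qi Qi ; (inj₂ i≡b) → i≢b i≡b }
      He≡0 : ∀ k → lincomb H e k ≡ 0#
      He≡0 k = begin
        lincomb H e k                            ≡⟨ lincomb-+ c′ (λ i → c b * d i) k ⟩
        lincomb H c′ k + lincomb H (λ i → c b * d i) k
          ≡⟨ cong (lincomb H c′ k +_) (trans (lincomb-*ˡ (c b) d k) (cong (c b *_) (sym (Hb≡Hd k)))) ⟩
        lincomb H c′ k + c b * H b k             ≡⟨ +-comm _ _ ⟩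
        c b * H b k + lincomb H c′ k             ≡⟨ sym (lincomb-split c b k) ⟩
        lincomb H c k                            ≡⟨ Hc≡0 k ⟩
        0#                                       ∎
        where open ≡-Reasoning
      e≡0 : ∀ i → e i ≡ 0#
      e≡0 = indQ e e∣Q He≡0
      cb≡0 : c b ≡ 0#
      cb≡0 = x*y≡0⇒y≡0 (d a) (c b) (begin
        d a * c b                ≡⟨ *-comm _ _ ⟩
        c b * d a                ≡⟨ sym (+-identityˡ _) ⟩
        0# + c b * d a           ≡⟨ cong (_+ c b * d a) (sym (trans (update-other c 0# a≢b) ca≡0)) ⟩
        e a                      ≡⟨ e≡0 a ⟩
        0#                       ∎) da≢0
        where
        open ≡-Reasoning
        ca≡0 : c a ≡ 0#
        ca≡0 = c∣Q′ a λ { (inj₁ (_ , a≢a)) → a≢a refl ; (inj₂ a≡b) → a≢b a≡b }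
      c≡0 : ∀ i → c i ≡ 0#
      c≡0 i with i ≟ b
      ... | yes refl = cb≡0
      ... | no i≢b  = trans (sym (+-identityʳ _))
        (trans (cong₂ _+_ (sym (update-other c 0# i≢b)) (sym (trans (cong (_* d i) cb≡0) (zeroˡ _)))) (e≡0 i))

  dualBasis-transport : ∀ {T T′} {H : Fin T → V} {H′ : Fin T′ → V} {Q : Fin T → Set} (ψ : Fin T′ → Fin T) →
    (∀ j → NonZeroV (H′ j)) → (∀ j → Proportional (H′ j) (H (ψ j))) → (∀ {i j} → ψ i ≡ ψ j → i ≡ j) →
    (∀ j → Q (ψ j)) → DualBasisOn H Q → DualBasisOn H′ (λ _ → Unit)
  dualBasis-transport {T′ = T′} {H} {H′} ψ H′≢0 H′∝Hψ ψ-injective Qψ (φ , φ-dual) = φ′ , φ′-dual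
    where
    α : Fin T′ → Carrier
    α j = proj₁ (H′∝Hψ j)
    α⁻¹ : Fin T′ → Carrier
    α⁻¹ j = inv (α j) (proportional-factor≢0 (H′≢0 j) (H′∝Hψ j))
    φ′ : Fin T′ → V
    φ′ j m = α⁻¹ j * φ (ψ j) m
    φ′-dual : ∀ {i j} → Unit → Unit → dot (φ′ i) (H′ j) ≡ δ i j
    φ′-dual {i} {j} _ _ = begin
      dot (φ′ i) (H′ j)                        ≡⟨ dot-*ˡ (α⁻¹ i) (φ (ψ i)) (H′ j) ⟩
      α⁻¹ i * dot (φ (ψ i)) (H′ j)             ≡⟨ cong (α⁻¹ i *_) (trans (dot-cong (φ (ψ i)) (proj₂ (H′∝Hψ j))) (dot-*ʳ (α j) (φ (ψ i)) (H (ψ j)))) ⟩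
      α⁻¹ i * (α j * dot (φ (ψ i)) (H (ψ j)))  ≡⟨ cong (λ z → α⁻¹ i * (α j * z)) (φ-dual (Qψ i) (Qψ j)) ⟩
      α⁻¹ i * (α j * δ (ψ i) (ψ j))            ≡⟨ by-cases (i ≟ j) ⟩
      δ i j                                    ∎
      where
      open ≡-Reasoning
      by-cases : Dec (i ≡ j) → α⁻¹ i * (α j * δ (ψ i) (ψ j)) ≡ δ i j
      by-cases (yes refl) = trans (cong (λ z → α⁻¹ i * (α i * z)) (δ-refl (ψ i)))
        (trans (cong (α⁻¹ i *_) (*-identityʳ _)) (trans (*-inverseˡ _ _) (sym (δ-refl i))))
      by-cases (no i≢j) = trans (cong (λ z → α⁻¹ i * (α j * z)) (δ-≢ (i≢j ∘ ψ-injective)))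
        (trans (cong (α⁻¹ i *_) (zeroʳ _)) (trans (zeroʳ _) (sym (δ-≢ i≢j))))

  independent⇒B-all-but-first : (H : Fin (suc n) → V) → IndependentOn H (λ _ → Unit) → B H (false ∷ ⊤)
  independent⇒B-all-but-first H indH = ∣⊤∣≡n n , positive , minimal , independent-mono H (λ _ → tt) indH
    where
    positive : ∀ i → i ∈ false ∷ ⊤ → 1 ≤ toℕ i
    positive (fs i) _ = s≤s z≤n
    minimal : ∀ l → l ∈ false ∷ ⊤ → ∀ j → InSpanOf H (λ i → i ∈ false ∷ ⊤ × toℕ l ≤ toℕ i) (H j) → toℕ l ≤ toℕ j
    minimal l _ j Hj∈span with toℕ l ≤? toℕ j
    ... | yes l≤j = l≤j
    ... | no l≰j  = ⊥-elim (independent⇒∉span H indH tt (λ _ → tt) (λ (_ , l≤j) → l≰j l≤j) Hj∈span)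

  independent⇒1≤count : ∀ {T′ k} (H : Fin T′ → V) → T′ ≡ suc n → IndependentOn H (λ _ → Unit) → Count (B H) k → 1 ≤ k
  independent⇒1≤count H refl indH (xs , _ , _ , complete , refl) = nonempty (complete _ (independent⇒B-all-but-first H indH))
    where
    nonempty : ∀ {S} {Ss : List (Subset (suc n))} → S ∈ₗ Ss → 1 ≤ length Ss
    nonempty (here _)  = s≤s z≤n
    nonempty (there _) = s≤s z≤n

module Reordering (F : RealField) (n : ℕ) {T : ℕ} (G : Fin T → Lin.V F n)
                  (G≢0 : ∀ i → Lin.NonZeroV F n (G i)) where

  open RealField F hiding (_≤ᵣ_)
  open Lin F n
  open LinearAlgebra F n

  Tail : (Fin T → ℕ) → Subset T → Fin T → Fin T → Set
  Tail ρ S l i = i ∈ S × ρ l ≤ ρ i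

  Tail? : ∀ ρ S l i → Dec (Tail ρ S l i)
  Tail? ρ S l i = (i ∈? S) ×-dec (ρ l ≤? ρ i)

  -- The condition B of Defs, with the points ordered by ρ instead of by their index.
  record B[_] (ρ : Fin T → ℕ) (S : Subset T) : Set where
    field
      size        : ∣ S ∣ ≡ n
      positive    : ∀ {i} → i ∈ S → 1 ≤ ρ i
      minimal     : ∀ {l} → l ∈ S → ∀ j → InSpanOf G (Tail ρ S l) (G j) → ρ l ≤ ρ j
      independent : LinIndepOn G S

  B⇒B[toℕ] : ∀ {S} → B G S → B[ toℕ ] S
  B⇒B[toℕ] (size , positive , minimal , independent) =
    record { size = size ; positive = positive _ ; minimal = minimal _ ; independent = independent }

  module AdjacentSwap (ρ : Fin T → ℕ) (ρ-injective : ∀ {i j} → ρ i ≡ ρ j → i ≡ j)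
                      {a b : Fin T} {t : ℕ} (ρa≡t : ρ a ≡ t) (ρb≡1+t : ρ b ≡ suc t) where

    a≢b : a ≢ b
    a≢b a≡b = ℕ.<⇒≢ (ℕ.n<1+n t) (trans (sym ρa≡t) (trans (cong ρ a≡b) ρb≡1+t))

    b≢a : b ≢ a
    b≢a = a≢b ∘ sym

    τ : Fin T → Fin T
    τ = transpose a b

    τa≡b : τ a ≡ b
    τa≡b rewrite dec-true (a ≟ a) refl = refl

    τb≡a : τ b ≡ a
    τb≡a rewrite dec-false (b ≟ a) b≢a | dec-true (b ≟ b) refl = refl

    τ-elsewhere : ∀ {i} → i ≢ a → i ≢ b → τ i ≡ i
    τ-elsewhere {i} i≢a i≢b rewrite dec-false (i ≟ a) i≢a | dec-false (i ≟ b) i≢b = refl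

    ρ′ : Fin T → ℕ
    ρ′ = ρ ∘ τ

    ρ′a≡1+t : ρ′ a ≡ suc t
    ρ′a≡1+t = trans (cong ρ τa≡b) ρb≡1+t

    ρ′b≡t : ρ′ b ≡ t
    ρ′b≡t = trans (cong ρ τb≡a) ρa≡t

    ρ′-elsewhere : ∀ {i} → i ≢ a → i ≢ b → ρ′ i ≡ ρ i
    ρ′-elsewhere i≢a i≢b = cong ρ (τ-elsewhere i≢a i≢b)

    ≢a⇒ρ≢t : ∀ {i} → i ≢ a → ρ i ≢ t
    ≢a⇒ρ≢t i≢a ρi≡t = i≢a (ρ-injective (trans ρi≡t (sym ρa≡t)))

    ≢b⇒ρ≢1+t : ∀ {i} → i ≢ b → ρ i ≢ suc t
    ≢b⇒ρ≢1+t i≢b ρi≡1+t = i≢b (ρ-injective (trans ρi≡1+t (sym ρb≡1+t)))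

    data Position (i : Fin T) : Set where
      at-a      : i ≡ a → Position i
      at-b      : i ≡ b → Position i
      elsewhere : i ≢ a → i ≢ b → Position i

    position : ∀ i → Position i
    position i with i ≟ a | i ≟ b
    ... | yes i≡a | _       = at-a i≡a
    ... | no _    | yes i≡b = at-b i≡b
    ... | no i≢a  | no i≢b  = elsewhere i≢a i≢b

    -- Only the threshold t + 1 separates a from b, so comparisons with any other value agree for ρ and ρ′.
    ≤ρ⇒≤ρ′ : ∀ {x} j → x ≢ suc t → x ≤ ρ j → x ≤ ρ′ j
    ≤ρ⇒≤ρ′ j x≢1+t x≤ρj with position j
    ... | at-a refl = subst (_ ≤_) (sym ρ′a≡1+t) (ℕ.m≤n⇒m≤1+n (subst (_ ≤_) ρa≡t x≤ρj))
    ... | at-b refl = subst (_ ≤_) (sym ρ′b≡t) (ℕ.≤-pred (ℕ.≤∧≢⇒< (subst (_ ≤_) ρb≡1+t x≤ρj) x≢1+t))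
    ... | elsewhere j≢a j≢b = subst (_ ≤_) (sym (ρ′-elsewhere j≢a j≢b)) x≤ρj

    ≤ρ′⇒≤ρ : ∀ {x} j → x ≢ suc t → x ≤ ρ′ j → x ≤ ρ j
    ≤ρ′⇒≤ρ j x≢1+t x≤ρ′j with position j
    ... | at-a refl = subst (_ ≤_) (sym ρa≡t) (ℕ.≤-pred (ℕ.≤∧≢⇒< (subst (_ ≤_) ρ′a≡1+t x≤ρ′j) x≢1+t))
    ... | at-b refl = subst (_ ≤_) (sym ρb≡1+t) (ℕ.m≤n⇒m≤1+n (subst (_ ≤_) ρ′b≡t x≤ρ′j))
    ... | elsewhere j≢a j≢b = subst (_ ≤_) (ρ′-elsewhere j≢a j≢b) x≤ρ′j

    t≢1+t : t ≢ suc t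
    t≢1+t = ℕ.<⇒≢ (ℕ.n<1+n t)

    t≤ρ′⇒ρa≤ρ : ∀ l {i} → t ≤ ρ′ l → ρ′ l ≤ ρ′ i → ρ a ≤ ρ i
    t≤ρ′⇒ρa≤ρ l {i} t≤ρ′l ρ′l≤ρ′i = subst (_≤ ρ i) (sym ρa≡t) (≤ρ′⇒≤ρ i t≢1+t (ℕ.≤-trans t≤ρ′l ρ′l≤ρ′i))

    ρ′≤ρ′⇒ρ≤ρ : ∀ {l i} → l ≢ a → l ≢ b → ρ′ l ≤ ρ′ i → ρ l ≤ ρ i
    ρ′≤ρ′⇒ρ≤ρ {i = i} l≢a l≢b ρ′l≤ρ′i = ≤ρ′⇒≤ρ i (≢b⇒ρ≢1+t l≢b) (subst (_≤ ρ′ i) (ρ′-elsewhere l≢a l≢b) ρ′l≤ρ′i)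

    ρ≤ρ⇒ρ′≤ρ′ : ∀ {l j} → l ≢ a → l ≢ b → ρ l ≤ ρ j → ρ′ l ≤ ρ′ j
    ρ≤ρ⇒ρ′≤ρ′ {j = j} l≢a l≢b ρl≤ρj = subst (_≤ ρ′ j) (sym (ρ′-elsewhere l≢a l≢b)) (≤ρ⇒≤ρ′ j (≢b⇒ρ≢1+t l≢b) ρl≤ρj)

    t≤ρ′a : t ≤ ρ′ a
    t≤ρ′a = subst (t ≤_) (sym ρ′a≡1+t) (ℕ.n≤1+n t)

    tail′⊆tail-a : ∀ {S} l → t ≤ ρ′ l → ∀ {i} → Tail ρ′ S l i → Tail ρ S a i
    tail′⊆tail-a l t≤ρ′l (i∈S , ρ′l≤ρ′i) = i∈S , t≤ρ′⇒ρa≤ρ l t≤ρ′l ρ′l≤ρ′i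

    Exchangeable : Subset T → Set
    Exchangeable S = a ∈ S × b ∉ S × InSpanOf G (Tail ρ S a) (G b)

    module _ {S : Subset T} (BS : B[ ρ ] S) where
      open B[_] BS

      private
        kept-minimal-a : a ∈ S → ¬ Exchangeable S → ∀ j → InSpanOf G (Tail ρ′ S a) (G j) → suc t ≤ ρ′ j
        kept-minimal-a a∈S ¬exch j Gj∈span with position j
        ... | at-a refl = subst (suc t ≤_) (sym ρ′a≡1+t) ℕ.≤-refl
        ... | at-b refl with b ∈? S
        ...   | yes b∈S = ⊥-elim (independent⇒∉span G independent b∈S proj₁ b∉tail Gj∈span)
          where
          b∉tail : ¬ Tail ρ′ S a b
          b∉tail (_ , ρ′a≤ρ′b) = ℕ.1+n≰n (subst₂ _≤_ ρ′a≡1+t ρ′b≡t ρ′a≤ρ′b)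
        ...   | no b∉S = ⊥-elim (¬exch (a∈S , b∉S , span-mono G (tail′⊆tail-a a t≤ρ′a) Gj∈span))
        kept-minimal-a a∈S ¬exch j Gj∈span | elsewhere j≢a j≢b =
          subst (suc t ≤_) (sym (ρ′-elsewhere j≢a j≢b)) (ℕ.≤∧≢⇒< t≤ρj (λ t≡ρj → ≢a⇒ρ≢t j≢a (sym t≡ρj)))
          where
          t≤ρj : t ≤ ρ j
          t≤ρj = subst (_≤ ρ j) ρa≡t (minimal a∈S j (span-mono G (tail′⊆tail-a a t≤ρ′a) Gj∈span))

        kept-minimal-b : b ∈ S → ∀ j → InSpanOf G (Tail ρ′ S b) (G j) → t ≤ ρ j
        kept-minimal-b b∈S j Gj∈span with a ∈? S
        ... | yes a∈S = subst (_≤ ρ j) ρa≡t (minimal a∈S j (span-mono G (tail′⊆tail-a b t≤ρ′b) Gj∈span))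
          where
          t≤ρ′b : t ≤ ρ′ b
          t≤ρ′b = ℕ.≤-reflexive (sym ρ′b≡t)
        ... | no a∉S  = ℕ.≤-trans (ℕ.n≤1+n t) (subst (_≤ ρ j) ρb≡1+t (minimal b∈S j (span-mono G tail′⊆tail Gj∈span)))
          where
          tail′⊆tail : ∀ {i} → Tail ρ′ S b i → Tail ρ S b i
          tail′⊆tail {i} (i∈S , ρ′b≤ρ′i) = i∈S , subst (_≤ ρ i) (sym ρb≡1+t)
            (ℕ.≤∧≢⇒< (subst (_≤ ρ i) ρa≡t (t≤ρ′⇒ρa≤ρ b (ℕ.≤-reflexive (sym ρ′b≡t)) ρ′b≤ρ′i))
                      (λ t≡ρi → ≢a⇒ρ≢t (λ { refl → a∉S i∈S }) (sym t≡ρi)))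

      B-kept : ¬ Exchangeable S → (b ∈ S → 1 ≤ t) → B[ ρ′ ] S
      B-kept ¬exch b∈S⇒1≤t = record { size = size ; positive = positive′ ; minimal = minimal′ ; independent = independent }
        where
        positive′ : ∀ {i} → i ∈ S → 1 ≤ ρ′ i
        positive′ {i} i∈S with position i
        ... | at-a refl = subst (1 ≤_) (sym ρ′a≡1+t) (s≤s z≤n)
        ... | at-b refl = subst (1 ≤_) (sym ρ′b≡t) (b∈S⇒1≤t i∈S)
        ... | elsewhere i≢a i≢b = subst (1 ≤_) (sym (ρ′-elsewhere i≢a i≢b)) (positive i∈S)
        minimal′ : ∀ {l} → l ∈ S → ∀ j → InSpanOf G (Tail ρ′ S l) (G j) → ρ′ l ≤ ρ′ j
        minimal′ {l} l∈S j Gj∈span with position l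
        ... | at-a refl = subst (_≤ ρ′ j) (sym ρ′a≡1+t) (kept-minimal-a l∈S ¬exch j Gj∈span)
        ... | at-b refl = subst (_≤ ρ′ j) (sym ρ′b≡t) (≤ρ⇒≤ρ′ j t≢1+t (kept-minimal-b l∈S j Gj∈span))
        ... | elsewhere l≢a l≢b = ρ≤ρ⇒ρ′≤ρ′ l≢a l≢b
          (minimal l∈S j (span-mono G (λ (i∈S , le) → i∈S , ρ′≤ρ′⇒ρ≤ρ l≢a l≢b le) Gj∈span))

      private
        coefficient-at-a≢0 : b ∉ S → ∀ d → (∀ i → ¬ Tail ρ S a i → d i ≡ 0#) → (∀ k → G b k ≡ lincomb G d k) → d a ≢ 0#
        coefficient-at-a≢0 b∉S d d∣tail Gb≡Gd da≡0 = absurd (any? Above?)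
          where
          Above : Fin T → Set
          Above i = i ∈ S × suc t ≤ ρ i
          Above? : ∀ i → Dec (Above i)
          Above? i = (i ∈? S) ×-dec (suc t ≤? ρ i)
          d∣Above : ∀ i → ¬ Above i → d i ≡ 0#
          d∣Above i ¬Above-i with Tail? ρ S a i
          ... | no ¬tail = d∣tail i ¬tail
          ... | yes (i∈S , ρa≤ρi) with ρ i ℕ.≟ t
          ...   | yes ρi≡t = subst (λ z → d z ≡ 0#) (ρ-injective (trans ρa≡t (sym ρi≡t))) da≡0
          ...   | no ρi≢t  = ⊥-elim (¬Above-i (i∈S , ℕ.≤∧≢⇒< (subst (_≤ ρ i) ρa≡t ρa≤ρi) (λ t≡ρi → ρi≢t (sym t≡ρi))))
          absurd : Dec (∃ Above) → ⊥
          absurd (yes (_ , Above-i)) with minimal-element ρ Above? Above-i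
          ... | l , (l∈S , 1+t≤ρl) , l-minimal = ≢b⇒ρ≢1+t (λ { refl → b∉S l∈S }) (ℕ.≤-antisym ρl≤1+t 1+t≤ρl)
            where
            ρl≤1+t : ρ l ≤ suc t
            ρl≤1+t = subst (ρ l ≤_) ρb≡1+t (minimal l∈S b (span-mono G (λ Ai → proj₁ Ai , l-minimal Ai) (d , d∣Above , Gb≡Gd)))
          absurd (no ∄Above) = G≢0 b λ k → trans (Gb≡Gd k) (lincomb-zero G (λ i → d∣Above i (λ Ai → ∄Above (i , Ai))) k)

        exchanged-minimal : Exchangeable S → ∀ {l} → l ∈ exchange S a b → ∀ j → InSpanOf G (Tail ρ′ (exchange S a b) l) (G j) → ρ′ l ≤ ρ′ j
        exchanged-minimal (a∈S , b∉S , Gb∈span) {l} l∈S′ j Gj∈span with position l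
        ... | at-a refl = ⊥-elim (x∉exchange a≢b l∈S′)
        ... | at-b refl = subst (_≤ ρ′ j) (sym ρ′b≡t)
          (≤ρ⇒≤ρ′ j t≢1+t (subst (_≤ ρ j) ρa≡t (minimal a∈S j (span-trans G (Tail? ρ′ (exchange S a b) b) generator Gj∈span))))
          where
          generator : ∀ {i} → Tail ρ′ (exchange S a b) b i → InSpanOf G (Tail ρ S a) (G i)
          generator {i} = by-cases (i ≟ b)
            where
            by-cases : Dec (i ≡ b) → Tail ρ′ (exchange S a b) b i → InSpanOf G (Tail ρ S a) (G i)
            by-cases (yes refl) _ = Gb∈span
            by-cases (no i≢b) (i∈S′ , ρ′b≤ρ′i) =
              generator∈span G (proj₁ (∈exchange⁻ i≢b i∈S′) , t≤ρ′⇒ρa≤ρ b (ℕ.≤-reflexive (sym ρ′b≡t)) ρ′b≤ρ′i)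
        ... | elsewhere l≢a l≢b = ρ≤ρ⇒ρ′≤ρ′ l≢a l≢b
          (minimal (proj₁ (∈exchange⁻ l≢b l∈S′)) j (span-trans G (Tail? ρ′ (exchange S a b) l) generator Gj∈span))
          where
          generator : ∀ {i} → Tail ρ′ (exchange S a b) l i → InSpanOf G (Tail ρ S l) (G i)
          generator {i} = by-cases (i ≟ b)
            where
            by-cases : Dec (i ≡ b) → Tail ρ′ (exchange S a b) l i → InSpanOf G (Tail ρ S l) (G i)
            by-cases (yes refl) (_ , ρ′l≤ρ′b) = span-mono G (λ (k∈S , ρa≤ρk) → k∈S , ℕ.≤-trans ρl≤ρa ρa≤ρk) Gb∈span
              where
              ρl≤ρa : ρ l ≤ ρ a
              ρl≤ρa = subst (ρ l ≤_) (sym ρa≡t) (subst₂ _≤_ (ρ′-elsewhere l≢a l≢b) ρ′b≡t ρ′l≤ρ′b)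
            by-cases (no i≢b) (i∈S′ , ρ′l≤ρ′i) = generator∈span G (proj₁ (∈exchange⁻ i≢b i∈S′) , ρ′≤ρ′⇒ρ≤ρ l≢a l≢b ρ′l≤ρ′i)

      B-exchanged : 1 ≤ t → Exchangeable S → B[ ρ′ ] (exchange S a b)
      B-exchanged 1≤t exch@(a∈S , b∉S , (d , d∣tail , Gb≡Gd)) = record
        { size = trans (∣exchange∣ a∈S b∉S) size ; positive = positive′ ; minimal = exchanged-minimal exch ; independent = independent′ }
        where
        S′ : Subset T
        S′ = exchange S a b
        positive′ : ∀ {i} → i ∈ S′ → 1 ≤ ρ′ i
        positive′ {i} i∈S′ with position i
        ... | at-a refl = ⊥-elim (x∉exchange a≢b i∈S′)
        ... | at-b refl = subst (1 ≤_) (sym ρ′b≡t) 1≤t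
        ... | elsewhere i≢a i≢b = subst (1 ≤_) (sym (ρ′-elsewhere i≢a i≢b)) (positive (proj₁ (∈exchange⁻ i≢b i∈S′)))
        independent′ : LinIndepOn G S′
        independent′ = independent-mono G S′⊆S-a+b
          (independent-exchange G d independent a∈S b∉S (λ i i∉S → d∣tail i (λ tail-i → i∉S (proj₁ tail-i))) Gb≡Gd
            (coefficient-at-a≢0 b∉S d d∣tail Gb≡Gd))
          where
          S′⊆S-a+b : ∀ {i} → i ∈ S′ → (i ∈ S × i ≢ a) ⊎ i ≡ b
          S′⊆S-a+b {i} i∈S′ with i ≟ b
          ... | yes i≡b = inj₂ i≡b
          ... | no i≢b  = inj₁ (∈exchange⁻ i≢b i∈S′)
      exchanged∉B : Exchangeable S → ¬ B[ ρ ] (exchange S a b)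
      exchanged∉B (a∈S , b∉S , (d , d∣tail , Gb≡Gd)) B-S′ = ℕ.1+n≰n (subst₂ _≤_ ρb≡1+t ρa≡t ρb≤ρa)
        where
        Ga∈span : InSpanOf G (λ i → (Tail ρ S a i × i ≢ a) ⊎ i ≡ b) (G a)
        Ga∈span = span-exchange G d (a∈S , ℕ.≤-refl) (λ tail-b → b∉S (proj₁ tail-b)) d∣tail Gb≡Gd
                    (coefficient-at-a≢0 b∉S d d∣tail Gb≡Gd)
        ⊆tail-b : ∀ {i} → (Tail ρ S a i × i ≢ a) ⊎ i ≡ b → Tail ρ (exchange S a b) b i
        ⊆tail-b {i} (inj₁ ((i∈S , ρa≤ρi) , i≢a)) = ∈exchange⁺ i≢a i∈S ,
          subst (_≤ ρ i) (sym ρb≡1+t) (ℕ.≤∧≢⇒< (subst (_≤ ρ i) ρa≡t ρa≤ρi) (λ t≡ρi → ≢a⇒ρ≢t i≢a (sym t≡ρi)))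
        ⊆tail-b (inj₂ refl) = y∈exchange , ℕ.≤-refl
        ρb≤ρa : ρ b ≤ ρ a
        ρb≤ρa = B[_].minimal B-S′ y∈exchange a (span-mono G ⊆tail-b Ga∈span)

      t≡0⇒a∉S : t ≡ 0 → a ∉ S
      t≡0⇒a∉S t≡0 a∈S = ℕ.1+n≰n (subst (1 ≤_) (trans ρa≡t t≡0) (positive a∈S))

      module _ (t≡0 : t ≡ 0) (b∈S : b ∈ S) where

        private
          S′ : Subset T
          S′ = exchange S b a

          a∉S : a ∉ S
          a∉S = t≡0⇒a∉S t≡0

          Ga∉spanS : ¬ InSpanOf G (_∈ S) (G a)
          Ga∉spanS Ga∈span = ℕ.1+n≰n (subst₂ _≤_ ρb≡1 (trans ρa≡t t≡0) (minimal b∈S a (span-mono G (λ i∈S → i∈S , ρb≤ρ i∈S) Ga∈span)))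
            where
            ρb≡1 : ρ b ≡ 1
            ρb≡1 = trans ρb≡1+t (cong suc t≡0)
            ρb≤ρ : ∀ {i} → i ∈ S → ρ b ≤ ρ i
            ρb≤ρ {i} i∈S = subst (_≤ ρ i) (sym ρb≡1) (positive i∈S)

          Without-b : Fin T → Set
          Without-b i = i ∈ S × i ≢ b

          S′⊆S-b+a : ∀ {i} → i ∈ S′ → Without-b i ⊎ i ≡ a
          S′⊆S-b+a {i} = by-cases (i ≟ a)
            where
            by-cases : Dec (i ≡ a) → i ∈ S′ → Without-b i ⊎ i ≡ a
            by-cases (yes i≡a) _    = inj₂ i≡a
            by-cases (no i≢a)  i∈S′ = inj₁ (∈exchange⁻ i≢a i∈S′)

          Gb∉span-a : ∀ d → (∀ i → ¬ Tail ρ′ S′ a i → d i ≡ 0#) → (∀ k → G b k ≡ lincomb G d k) → ⊥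
          Gb∉span-a d d∣tail′ Gb≡Gd = ¬¬-excluded-middle absurd
            where
            absurd : Dec (d a ≡ 0#) → ⊥
            absurd (yes da≡0) = independent⇒∉span G independent b∈S proj₁ (λ (_ , b≢b) → b≢b refl) (d , d∣S-b , Gb≡Gd)
              where
              d∣S-b : ∀ i → ¬ Without-b i → d i ≡ 0#
              d∣S-b i ¬Wi with Tail? ρ′ S′ a i
              ... | no ¬tail = d∣tail′ i ¬tail
              ... | yes (i∈S′ , _) with S′⊆S-b+a i∈S′
              ...   | inj₁ Wi   = ⊥-elim (¬Wi Wi)
              ...   | inj₂ refl = da≡0
            absurd (no da≢0) = Ga∉spanS (span-mono G ⊆S
              (span-exchange G d (y∈exchange , ℕ.≤-refl) (λ (b∈S′ , _) → x∉exchange b≢a b∈S′) d∣tail′ Gb≡Gd da≢0))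
              where
              ⊆S : ∀ {i} → (Tail ρ′ S′ a i × i ≢ a) ⊎ i ≡ b → i ∈ S
              ⊆S (inj₁ ((i∈S′ , _) , i≢a)) = proj₁ (∈exchange⁻ i≢a i∈S′)
              ⊆S (inj₂ refl)               = b∈S

          front-minimal-a : ∀ j → InSpanOf G (Tail ρ′ S′ a) (G j) → 1 ≤ ρ′ j
          front-minimal-a j Gj∈span with position j
          ... | at-a refl = subst (1 ≤_) (sym ρ′a≡1+t) (s≤s z≤n)
          ... | at-b refl = ⊥-elim (Gb∉span-a (proj₁ Gj∈span) (proj₁ (proj₂ Gj∈span)) (proj₂ (proj₂ Gj∈span)))
          ... | elsewhere j≢a j≢b = subst (1 ≤_) (sym (ρ′-elsewhere j≢a j≢b)) (ℕ.n≢0⇒n>0 (λ ρj≡0 → ≢a⇒ρ≢t j≢a (trans ρj≡0 (sym t≡0))))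

          front-minimal-elsewhere : ∀ {l} → l ≢ a → l ≢ b → l ∈ S′ → ∀ j → InSpanOf G (Tail ρ′ S′ l) (G j) → ρ′ l ≤ ρ′ j
          front-minimal-elsewhere {l} l≢a l≢b l∈S′ j Gj∈span = ρ≤ρ⇒ρ′≤ρ′ l≢a l≢b (minimal l∈S j (span-mono G tail′⊆tail Gj∈span))
            where
            l∈S : l ∈ S
            l∈S = proj₁ (∈exchange⁻ l≢a l∈S′)
            1<ρl : 1 < ρ l
            1<ρl = ℕ.≤∧≢⇒< (positive l∈S) (λ 1≡ρl → ≢b⇒ρ≢1+t l≢b (trans (sym 1≡ρl) (cong suc (sym t≡0))))
            tail′⊆tail : ∀ {i} → Tail ρ′ S′ l i → Tail ρ S l i
            tail′⊆tail {i} = by-cases (i ≟ a)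
              where
              by-cases : Dec (i ≡ a) → Tail ρ′ S′ l i → Tail ρ S l i
              by-cases (yes refl) (_ , ρ′l≤ρ′a) =
                ⊥-elim (ℕ.<⇒≱ 1<ρl (subst₂ _≤_ (ρ′-elsewhere l≢a l≢b) (trans ρ′a≡1+t (cong suc t≡0)) ρ′l≤ρ′a))
              by-cases (no i≢a) (i∈S′ , ρ′l≤ρ′i) = proj₁ (∈exchange⁻ i≢a i∈S′) , ρ′≤ρ′⇒ρ≤ρ l≢a l≢b ρ′l≤ρ′i

        B-front-exchanged : ¬ ¬ B[ ρ′ ] (exchange S b a)
        B-front-exchanged = (λ independent′ → record
          { size = trans (∣exchange∣ b∈S a∉S) size ; positive = positive′ ; minimal = minimal′ ; independent = independent′ })
          <$> (independent-mono G S′⊆S-b+a <$> independent-extend G (λ i → (i ∈? S) ×-dec ¬? (i ≟ b))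
                (independent-mono G proj₁ independent) (λ (a∈S , _) → a∉S a∈S) (λ sp → Ga∉spanS (span-mono G proj₁ sp)))
          where
          positive′ : ∀ {i} → i ∈ S′ → 1 ≤ ρ′ i
          positive′ {i} i∈S′ with position i
          ... | at-a refl = subst (1 ≤_) (sym ρ′a≡1+t) (s≤s z≤n)
          ... | at-b refl = ⊥-elim (x∉exchange b≢a i∈S′)
          ... | elsewhere i≢a i≢b = subst (1 ≤_) (sym (ρ′-elsewhere i≢a i≢b)) (positive (proj₁ (∈exchange⁻ i≢a i∈S′)))
          minimal′ : ∀ {l} → l ∈ S′ → ∀ j → InSpanOf G (Tail ρ′ S′ l) (G j) → ρ′ l ≤ ρ′ j
          minimal′ {l} l∈S′ j Gj∈span with position l
          ... | at-a refl = subst (_≤ ρ′ j) (sym (trans ρ′a≡1+t (cong suc t≡0))) (front-minimal-a j Gj∈span)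
          ... | at-b refl = ⊥-elim (x∉exchange b≢a l∈S′)
          ... | elsewhere l≢a l≢b = front-minimal-elsewhere l≢a l≢b l∈S′ j Gj∈span

    front-exchanged∉B : ∀ {S} → t ≡ 0 → ¬ B[ ρ ] (exchange S b a)
    front-exchanged∉B t≡0 B-S′ = ℕ.1+n≰n (subst (1 ≤_) (trans ρa≡t t≡0) (B[_].positive B-S′ y∈exchange))

    swap≼ : 1 ≤ t → B[ ρ ] ≼ B[ ρ′ ]
    swap≼ 1≤t = ≼-fix-or-move Exchangeable (λ S → exchange S a b)
      (λ BS ¬exch → B-kept BS ¬exch (λ _ → 1≤t))
      (λ BS exch → pure (B-exchanged BS 1≤t exch))
      exchanged∉B
      (λ _ _ (a∈S , b∉S , _) (a∈S' , b∉S' , _) → exchange-injective a∈S b∉S a∈S' b∉S')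

    front-swap≼ : t ≡ 0 → B[ ρ ] ≼ B[ ρ′ ]
    front-swap≼ t≡0 = ≼-fix-or-move (b ∈_) (λ S → exchange S b a)
      (λ BS b∉S → B-kept BS (λ (a∈S , _) → t≡0⇒a∉S BS t≡0 a∈S) (⊥-elim ∘ b∉S))
      (λ BS b∈S → B-front-exchanged BS t≡0 b∈S)
      (λ _ _ → front-exchanged∉B t≡0)
      (λ BS BS' b∈S b∈S' → exchange-injective b∈S (t≡0⇒a∉S BS t≡0) b∈S' (t≡0⇒a∉S BS' t≡0))

    adjacent-swap≼ : B[ ρ ] ≼ B[ ρ′ ]
    adjacent-swap≼ with t ℕ.≟ 0
    ... | yes t≡0 = front-swap≼ t≡0
    ... | no t≢0  = swap≼ (ℕ.n≢0⇒n>0 t≢0)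

  record IsOrder (ρ : Fin T → ℕ) : Set where
    field
      injective       : ∀ {i j} → ρ i ≡ ρ j → i ≡ j
      downward-closed : ∀ {i m} → m < ρ i → ∃ λ j → ρ j ≡ m

  toℕ-isOrder : IsOrder toℕ
  toℕ-isOrder = record
    { injective = toℕ-injective
    ; downward-closed = λ {i} m<i → fromℕ< (ℕ.<-trans m<i (toℕ<n i)) , toℕ-fromℕ< _
    }

  ∘-bijection-isOrder : ∀ {ρ} → IsOrder ρ → ∀ τ σ → (∀ k → τ (σ k) ≡ k) → (∀ k → σ (τ k) ≡ k) → IsOrder (ρ ∘ τ)
  ∘-bijection-isOrder {ρ} ρ-order τ σ τσ≗id στ≗id = record
    { injective = λ {i} {j} ρτi≡ρτj → trans (sym (στ≗id i)) (trans (cong σ (injective ρτi≡ρτj)) (στ≗id j))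
    ; downward-closed = λ m<ρτi → let (j , ρj≡m) = downward-closed m<ρτi in σ j , trans (cong ρ (τσ≗id j)) ρj≡m
    }
    where open IsOrder ρ-order

  move-to-front : ∀ g {ρ} → IsOrder ρ → ∃ λ ρ′ → ρ′ g ≡ 0 × B[ ρ ] ≼ B[ ρ′ ]
  move-to-front g {ρ} ρ-order = go (ρ g) ρ-order refl
    where
    go : ∀ t {ρ} → IsOrder ρ → ρ g ≡ t → ∃ λ ρ′ → ρ′ g ≡ 0 × B[ ρ ] ≼ B[ ρ′ ]
    go zero {ρ} _ ρg≡0 = ρ , ρg≡0 , ≼-refl
    go (suc t) {ρ} ρ-order ρg≡1+t = step (IsOrder.downward-closed ρ-order (ℕ.≤-reflexive (sym ρg≡1+t)))
      where
      step : (∃ λ a → ρ a ≡ t) → ∃ λ ρ′ → ρ′ g ≡ 0 × B[ ρ ] ≼ B[ ρ′ ]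
      step (a , ρa≡t) = let (ρ″ , ρ″g≡0 , ρ′≼ρ″) = go t ρ′-order ρ′b≡t in ρ″ , ρ″g≡0 , ≼-trans adjacent-swap≼ ρ′≼ρ″
        where
        open AdjacentSwap ρ (IsOrder.injective ρ-order) ρa≡t ρg≡1+t
        ρ′-order : IsOrder ρ′
        ρ′-order = ∘-bijection-isOrder ρ-order τ (transpose g a) (λ _ → transpose-inverse a g) (λ _ → transpose-inverse g a)

module Counting (F : RealField) (n : ℕ) (1≤n : 1 ≤ n) {T : ℕ} (H : Fin T → Lin.V F n)
  (w : Lin.V F n) (w≢0 : Lin.NonZeroV F n w) {TG : ℕ} (G : Fin TG → Lin.V F n) (G-distinct : Lin.Distinct F n G)
  (G-enumerates : Lin.Enumerates F n G (λ v → Lin.Proportional F n v w ⊎ (∃ λ i → Lin.Proportional F n v (H i)))) where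

  open RealField F hiding (_≤ᵣ_)
  open Lin F n
  open LinearAlgebra F n

  G≢0 : ∀ j → NonZeroV (G j)
  G≢0 = proj₁ G-distinct

  open Reordering F n G G≢0

  Point : Subset T → V → Set
  Point S v = Proportional v w ⊎ (∃ λ i → i ∈ S × Proportional v (H i))

  same-index : ∀ {x y u} → Proportional (G x) u → Proportional (G y) u → x ≡ y
  same-index {y = y} Gx∝u Gy∝u = proj₂ G-distinct _ _ (proportional-trans Gx∝u (proportional-sym (G≢0 y) Gy∝u))

  g₀ : Fin TG
  g₀ = proj₁ (proj₁ (G-enumerates w w≢0) (inj₁ (proportional-refl w)))

  w∝Gg₀ : Proportional w (G g₀)
  w∝Gg₀ = proj₂ (proj₁ (G-enumerates w w≢0) (inj₁ (proportional-refl w)))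

  H-index : Fin TG → Maybe (Fin T)
  H-index j with proj₂ (G-enumerates (G j) (G≢0 j)) (j , proportional-refl (G j))
  ... | inj₁ _       = nothing
  ... | inj₂ (i , _) = just i

  H-index-just : ∀ {j i} → H-index j ≡ just i → Proportional (G j) (H i)
  H-index-just {j} eq with proj₂ (G-enumerates (G j) (G≢0 j)) (j , proportional-refl (G j))
  H-index-just {j} refl | inj₂ (i , Gj∝Hi) = Gj∝Hi

  H-index-nothing : ∀ {j} → H-index j ≡ nothing → j ≡ g₀
  H-index-nothing {j} eq with proj₂ (G-enumerates (G j) (G≢0 j)) (j , proportional-refl (G j))
  H-index-nothing {j} refl | inj₁ Gj∝w = same-index (proportional-trans Gj∝w w∝Gg₀) (proportional-refl (G g₀))

  H-index-injective : ∀ {j j' i} → H-index j ≡ just i → H-index j' ≡ just i → j ≡ j'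
  H-index-injective eq eq' = same-index (H-index-just eq) (H-index-just eq')

  Preimage : Subset TG → Fin T → Set
  Preimage X i = ∃ λ j → j ∈ X × H-index j ≡ just i

  preimage? : ∀ X i → Dec (Preimage X i)
  preimage? X i = any? (λ j → (j ∈? X) ×-dec Maybe.≡-dec _≟_ (H-index j) (just i))

  H-indices : Subset TG → Subset T
  H-indices X = subsetOf (preimage? X)

  ∈H-indices⁺ : ∀ {X j i} → j ∈ X → H-index j ≡ just i → i ∈ H-indices X
  ∈H-indices⁺ {X} j∈X eq = ∈-subsetOf⁺ (preimage? X) (_ , j∈X , eq)

  ∈H-indices⁻ : ∀ {X i} → i ∈ H-indices X → Preimage X i
  ∈H-indices⁻ {X} = ∈-subsetOf⁻ (preimage? X)

  ρ : Fin TG → ℕ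
  ρ = proj₁ (move-to-front g₀ toℕ-isOrder)

  ρg₀≡0 : ρ g₀ ≡ 0
  ρg₀≡0 = proj₁ (proj₂ (move-to-front g₀ toℕ-isOrder))

  B≼B[ρ] : B[ toℕ ] ≼ B[ ρ ]
  B≼B[ρ] = proj₂ (proj₂ (move-to-front g₀ toℕ-isOrder))

  module _ {X : Subset TG} (BX : B[ ρ ] X) where
    open B[_] BX

    g₀∉X : g₀ ∉ X
    g₀∉X g₀∈X = ℕ.1+n≰n (subst (1 ≤_) ρg₀≡0 (positive g₀∈X))

    H-index-defined : ∀ {j} → j ∈ X → ∃ λ i → H-index j ≡ just i
    H-index-defined {j} j∈X with H-index j in eq
    ... | just i  = i , refl
    ... | nothing = ⊥-elim (g₀∉X (subst (_∈ X) (H-index-nothing eq) j∈X))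

    ∣H-indices∣ : ∣ H-indices X ∣ ≡ n
    ∣H-indices∣ = begin
      ∣ H-indices X ∣                 ≡⟨ sym (length-members (H-indices X)) ⟩
      length (members (H-indices X))  ≡⟨ sym (length-≡-by-correspondence (λ j i → H-index j ≡ just i)
                                             (members-unique X) (members-unique (H-indices X))
                                             (λ _ _ → H-index-injective)
                                             (λ _ _ eq eq′ → Maybe.just-injective (trans (sym eq) eq′))
                                             image preimage) ⟩
      length (members X)              ≡⟨ length-members X ⟩
      ∣ X ∣                           ≡⟨ size ⟩
      n                               ∎
      where
      open ≡-Reasoning
      image : ∀ {j} → j ∈ₗ members X → ∃ λ i → i ∈ₗ members (H-indices X) × H-index j ≡ just i
      image j∈ = let (i , eq) = H-index-defined (∈members⇒∈ j∈) in i , ∈⇒∈members (∈H-indices⁺ (∈members⇒∈ j∈) eq) , eq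
      preimage : ∀ {i} → i ∈ₗ members (H-indices X) → ∃ λ j → j ∈ₗ members X × H-index j ≡ just i
      preimage i∈ = let (j , j∈X , eq) = ∈H-indices⁻ (∈members⇒∈ i∈) in j , ∈⇒∈members j∈X , eq

    X-nonempty : ∃ (_∈ X)
    X-nonempty with members X in eq
    ... | []    = ⊥-elim (ℕ.1+n≰n (subst (1 ≤_) (trans (sym size) (trans (sym (length-members X)) (cong length eq))) 1≤n))
    ... | j ∷ _ = j , ∈members⇒∈ (subst (j ∈ₗ_) (sym eq) (here refl))

    Gg₀∉spanX : ¬ InSpanOf G (_∈ X) (G g₀)
    Gg₀∉spanX Gg₀∈span with minimal-element ρ (_∈? X) (proj₂ X-nonempty)
    ... | l , l∈X , l-minimal = ℕ.1+n≰n (subst (1 ≤_) ρg₀≡0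
      (ℕ.≤-trans (positive l∈X) (minimal l∈X g₀ (span-mono G (λ i∈X → i∈X , l-minimal i∈X) Gg₀∈span))))

    WithOrigin : Fin TG → Set
    WithOrigin g = g ∈ X ⊎ g ≡ g₀

    ¬¬dualBasis : ¬ ¬ DualBasisOn G WithOrigin
    ¬¬dualBasis = independent⇒¬¬dualBasis G (_∈? X) independent >>= λ (φ , φ-dual) →
      (λ (ψ , ψ-X , ψ-g₀) → dualBasis-extend G (_∈? X) φ φ-dual g₀∉X ψ ψ-X ψ-g₀)
        <$> ¬¬-separating-functional G (_∈? X) φ φ-dual Gg₀∉spanX

    module _ {T′ : ℕ} (G′ : Fin T′ → V) (G′-distinct : Distinct G′) (G′-enumerates : Enumerates G′ (Point (H-indices X))) where

      private
        G′≢0 : ∀ j′ → NonZeroV (G′ j′)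
        G′≢0 = proj₁ G′-distinct

        counterpart : ∀ j′ → ∃ λ g → Proportional (G′ j′) (G g) × WithOrigin g
        counterpart j′ with proj₂ (G′-enumerates (G′ j′) (G′≢0 j′)) (j′ , proportional-refl _)
        ... | inj₁ G′j′∝w = g₀ , proportional-trans G′j′∝w w∝Gg₀ , inj₂ refl
        ... | inj₂ (i , i∈ , G′j′∝Hi) with ∈H-indices⁻ i∈
        ...   | j , j∈X , eq = j , proportional-trans G′j′∝Hi (proportional-sym (G≢0 j) (H-index-just eq)) , inj₁ j∈X

        ψ : Fin T′ → Fin TG
        ψ j′ = proj₁ (counterpart j′)

        G′∝Gψ : ∀ j′ → Proportional (G′ j′) (G (ψ j′))
        G′∝Gψ j′ = proj₁ (proj₂ (counterpart j′))

        ψ-origin : ∀ j′ → WithOrigin (ψ j′)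
        ψ-origin j′ = proj₂ (proj₂ (counterpart j′))

        ψ-injective : ∀ {i′ j′} → ψ i′ ≡ ψ j′ → i′ ≡ j′
        ψ-injective {i′} {j′} ψi′≡ψj′ = proj₂ G′-distinct i′ j′
          (proportional-trans (G′∝Gψ i′) (proportional-sym (G′≢0 j′) (subst (λ g → Proportional (G′ j′) (G g)) (sym ψi′≡ψj′) (G′∝Gψ j′))))

        ψ-surjective : ∀ {g} → WithOrigin g → ∃ λ j′ → ψ j′ ≡ g
        ψ-surjective {g} origin-g with proj₁ (G′-enumerates (G g) (G≢0 g)) (point origin-g)
          where
          point : WithOrigin g → Point (H-indices X) (G g)
          point (inj₂ refl) = inj₁ (proportional-sym w≢0 w∝Gg₀)
          point (inj₁ g∈X)  = let (i , eq) = H-index-defined g∈X in inj₂ (i , ∈H-indices⁺ g∈X eq , H-index-just eq)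
        ... | j′ , Gg∝G′j′ = j′ , sym (same-index Gg∝G′j′ (proportional-sym (G′≢0 j′) (G′∝Gψ j′)))

        T′≡1+n : T′ ≡ suc n
        T′≡1+n = begin
          T′                      ≡⟨ sym (length-tabulate {n = T′} (λ j′ → j′)) ⟩
          length (allFin T′)      ≡⟨ length-≡-by-correspondence (λ j′ g → ψ j′ ≡ g) (Unique.allFin⁺ T′) origin-unique
                                       (λ _ _ eq eq′ → ψ-injective (trans eq (sym eq′))) (λ _ _ eq eq′ → trans (sym eq) eq′)
                                       (λ {j′} _ → ψ j′ , ∈origin (ψ-origin j′) , refl)
                                       (λ g∈ → let (j′ , eq) = ψ-surjective (origin∈ g∈) in j′ , ∈-allFin j′ , eq) ⟩
          length (g₀ ∷ members X) ≡⟨ cong suc (trans (length-members X) size) ⟩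
          suc n                   ∎
          where
          open ≡-Reasoning
          origin-unique : Unique (g₀ ∷ members X)
          origin-unique = All.tabulate (λ g∈ g₀≡g → g₀∉X (subst (_∈ X) (sym g₀≡g) (∈members⇒∈ g∈))) ∷ members-unique X
          ∈origin : ∀ {g} → WithOrigin g → g ∈ₗ g₀ ∷ members X
          ∈origin (inj₂ refl) = here refl
          ∈origin (inj₁ g∈X)  = there (∈⇒∈members g∈X)
          origin∈ : ∀ {g} → g ∈ₗ g₀ ∷ members X → WithOrigin g
          origin∈ (here refl) = inj₂ refl
          origin∈ (there g∈)  = inj₁ (∈members⇒∈ g∈)

      1≤count : ∀ {k} → Count (B G′) k → 1 ≤ k
      1≤count count = ¬¬-≤ ((λ D → independent⇒1≤count G′ T′≡1+n (dualBasis⇒independent G′ (λ _ → yes tt) D) count)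
        <$> (dualBasis-transport {H = G} ψ G′≢0 G′∝Gψ ψ-injective ψ-origin <$> ¬¬dualBasis))

  H-indices-injective : ∀ {X X'} → B[ ρ ] X → B[ ρ ] X' → H-indices X ≡ H-indices X' → X ≡ X'
  H-indices-injective BX BX' eq = ⊆-antisym (⊆-from BX eq) (⊆-from BX' (sym eq))
    where
    ⊆-from : ∀ {X X'} → B[ ρ ] X → H-indices X ≡ H-indices X' → X ⊆ X'
    ⊆-from {X} {X'} BX eq j∈X with H-index-defined BX j∈X
    ... | i , Hj≡i with ∈H-indices⁻ (subst (i ∈_) eq (∈H-indices⁺ j∈X Hj≡i))
    ...   | j' , j'∈X' , Hj'≡i = subst (_∈ X') (H-index-injective Hj'≡i Hj≡i) j'∈X'

  module _ (c : Subset T → ℕ) (η★-of-subsets : ∀ S → ∣ S ∣ ≡ n → EtaStar (Point S) (c S)) where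

    Counted : Subset T → Set
    Counted S = ∣ S ∣ ≡ n × 1 ≤ c S

    B[ρ]≼Counted : B[ ρ ] ≼ Counted
    B[ρ]≼Counted = record
      { R = λ X S → B[ ρ ] X × S ≡ H-indices X
      ; total = λ {X} BX → pure (H-indices X , BX , refl)
      ; sound = λ { (BX , refl) → ∣H-indices∣ BX , 1≤c BX }
      ; injective = λ BX BX' (_ , S≡) (_ , S≡') → H-indices-injective BX BX' (trans (sym S≡) S≡')
      }
      where
      1≤c : ∀ {X} → B[ ρ ] X → 1 ≤ c (H-indices X)
      1≤c BX with η★-of-subsets _ (∣H-indices∣ BX)
      ... | _ , G′ , G′-distinct , G′-enumerates , count = 1≤count BX G′ G′-distinct G′-enumerates count

    count≤sum : ∀ {k} → Count (B G) k → k ≤ sumOverNSubsets T c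
    count≤sum (xs , xs-unique , all-B , _ , refl) = ℕ.≤-trans
      (≼⇒length≤ (≼-trans B≼B[ρ] B[ρ]≼Counted) xs-unique (All.map B⇒B[toℕ] all-B) (∈-filter⁺ counted? (∈-allSubsets _)))
      (length-filter≤sum counted? summand summand-positive (allSubsets T))
      where
      counted? : ∀ S → Dec (Counted S)
      counted? S = (∣ S ∣ ℕ.≟ n) ×-dec (1 ≤? c S)
      summand : Subset T → ℕ
      summand S = if ∣ S ∣ ≡ᵇ n then c S else 0
      summand-positive : ∀ {S} → Counted S → 1 ≤ summand S
      summand-positive {S} (∣S∣≡n , 1≤cS) with ∣ S ∣ ≡ᵇ n | ℕ.≡⇒≡ᵇ ∣ S ∣ n ∣S∣≡n
      ... | true | _ = 1≤cS

theorem2 : (F : RealField) (n : ℕ) → 1 ≤ n →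
    (T : ℕ) (H : Fin T → Lin.V F n) → Lin.Distinct F n H →
    (w : Lin.V F n) → Lin.NonZeroV F n w →
    (k : ℕ) → Lin.EtaStar F n (λ v → Lin.Proportional F n v w ⊎ (∃ λ i → Lin.Proportional F n v (H i))) k →
    (c : Subset T → ℕ) →
    (∀ S → ∣ S ∣ ≡ n → Lin.EtaStar F n (λ v → Lin.Proportional F n v w ⊎ (∃ λ i → i ∈ S × Lin.Proportional F n v (H i))) (c S)) →
    k ≤ Lin.sumOverNSubsets F n T c
theorem2 F n 1≤n T H _ w w≢0 k (_ , G , G-distinct , G-enumerates , count) c η★-of-subsets =
  Counting.count≤sum F n 1≤n H w w≢0 G G-distinct G-enumerates c η★-of-subsets count
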